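{- Let $n \ge 4$. The $h$-vector of the Whitehouse complex $\Delta_n$ satisfies $$h_{n,k} = (k+1)\, h_{n-1,k} + (2n-k-5)\, h_{n-1,k-1}$$ for $0 \le k \le n-3$.
   Context: For $m \ge 3$, the Whitehouse complex $\Delta_m$ is the simplicial complex with vertex set $V_m = \{S \subseteq \{2,\ldots,m\} : 2 \le |S| \le m-2\}$, in which $F \subseteq V_m$ is a face iff any two $S,T \in F$ satisfy $S \subseteq T$, $T \subseteq S$, or $S \cap T = \emptyset$; it is pure of dimension $m-4$. Let $f_{m,i}$ be the number of $i$-dimensional faces of $\Delta_m$ (with $f_{m,-1}=1$). With $d = m-3$, the $h$-vector of $\Delta_m$ is $(h_{m,0},\ldots,h_{m,d})$ with $h_{m,k} = \sum_{i=0}^{k} (-1)^{k-i}\binom{d-i}{k-i} f_{m,i-1}$. By convention $h_{m,k}=0$ for $k<0$ or $k>m-3$. -}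

module Defs where

open import Data.Nat as ℕ using (ℕ; zero; suc; _∸_; _≤_; _≤?_)
open import Data.Nat.Combinatorics using (_C_)
open import Data.Integer as ℤ using (ℤ; +_; -[1+_]; -1ℤ; 0ℤ)
open import Data.Bool using (Bool; if_then_else_)
import Data.Bool.Properties as BoolP
open import Data.List using (List; []; _∷_; _++_; map; length; filter; foldr; upTo)
open import Data.List.Relation.Unary.AllPairs using (AllPairs; allPairs?)
open import Data.Fin.Subset using (Subset; inside; outside; _⊆_; _∩_; ∣_∣) renaming (⊥ to ∅)
open import Data.Fin.Subset.Properties using (_⊆?_)
open import Data.Vec using (Vec; []; _∷_)
open import Data.Vec.Properties using (≡-dec)
open import Data.Sum using (_⊎_)
open import Data.Product using (_×_)
open import Relation.Binary.PropositionalEquality using (_≡_)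
open import Relation.Nullary using (Dec; does; _⊎-dec_; _×-dec_)

allSubsets : (n : ℕ) → List (Subset n)
allSubsets zero = [] ∷ []
allSubsets (suc n) = map (inside ∷_) (allSubsets n) ++ map (outside ∷_) (allSubsets n)

sublists : ∀ {a} {A : Set a} → List A → List (List A)
sublists [] = [] ∷ []
sublists (x ∷ xs) = map (x ∷_) (sublists xs) ++ sublists xs

-- The ground set {2,…,m} is encoded as Fin (m ∸ 1) via j ↦ j + 2.
Ground : ℕ → ℕ
Ground m = m ∸ 1

IsVertex : (m : ℕ) → Subset (Ground m) → Set
IsVertex m S = (2 ≤ ∣ S ∣) × (∣ S ∣ ≤ m ∸ 2)

isVertex? : (m : ℕ) → (S : Subset (Ground m)) → Dec (IsVertex m S)
isVertex? m S = (2 ≤? ∣ S ∣) ×-dec (∣ S ∣ ≤? m ∸ 2)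

vertices : (m : ℕ) → List (Subset (Ground m))
vertices m = filter (isVertex? m) (allSubsets (Ground m))

Compatible : ∀ {n} → Subset n → Subset n → Set
Compatible S T = S ⊆ T ⊎ (T ⊆ S ⊎ S ∩ T ≡ ∅)

compatible? : ∀ {n} (S T : Subset n) → Dec (Compatible S T)
compatible? S T = (S ⊆? T) ⊎-dec ((T ⊆? S) ⊎-dec ≡-dec BoolP._≟_ (S ∩ T) ∅)

faces : (m : ℕ) → List (List (Subset (Ground m)))
faces m = filter (allPairs? compatible?) (sublists (vertices m))

-- F m j = number of faces with exactly j vertices, i.e. F m j = f_{m, j-1}
-- (in particular F m 0 = f_{m,-1} = 1, the empty face).
F : ℕ → ℕ → ℕ
F m j = length (filter (λ σ → length σ ℕ.≟ j) (faces m))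

sumℤ : List ℤ → ℤ
sumℤ = foldr ℤ._+_ 0ℤ

hSum : ℕ → ℕ → ℤ
hSum m k = sumℤ (map (λ i → (-1ℤ ℤ.^ (k ∸ i)) ℤ.* (+ ((d ∸ i) C (k ∸ i))) ℤ.* (+ F m i)) (upTo (suc k)))
  where d = m ∸ 3

h : ℕ → ℤ → ℤ
h m -[1+ _ ] = 0ℤ
h m (+ k) = if does (k ≤? m ∸ 3) then hSum m k else 0ℤ

module Submission where

-- Fix an extra ground element x. Deleting x from every set of a face σ of Δ_{m+1} (and
-- dropping what is no longer a vertex) gives a face τ of Δ_m, and σ is recovered from τ
-- together with a centre v and a bit b: the sets of τ containing v get x added, and if b is
-- set one further vertex appears (v itself, or v ∪ {x} when v is a singleton). The admissible
-- centres are the sets of τ and the whole ground set, and for b set also the m − 1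
-- singletons. Counting these triples gives
--   f_{m+1,j} = (j + 2) f_{m,j} + (m + j) f_{m,j-1}.
-- Substituting this into the alternating sum defining h and collecting coefficients, the
-- h-recurrence reduces, by Pascal's rule, to the absorption identity
--   (k + 1) C(k + e, k + 1) = e C(k + e, k).

open import Defs
open import Level using (Level)
open import Algebra.Bundles using (CommutativeSemiring)
open import Function using (_∘_; id; mk⇔; Equivalence)
open import Data.Bool using (Bool; true; false; if_then_else_)
import Data.Bool.Properties as Bool
open import Data.Empty using (⊥-elim)
open import Data.Product using (∃-syntax; _×_; _,_; proj₁; proj₂)
open import Data.Sum using (_⊎_; inj₁; inj₂)
open import Data.Nat as ℕ using (ℕ; zero; suc; _∸_; _≤_; _<_; z≤n; s≤s)
import Data.Nat.Properties as ℕ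
import Data.Nat.Solver as ℕ-Solver
open import Data.Nat.Combinatorics using (_C_; nCk+nC[k+1]≡[n+1]C[k+1]; nC1≡n; k>n⇒nCk≡0)
open import Data.Integer as ℤ using (ℤ; +_; -1ℤ; 0ℤ; 1ℤ)
import Data.Integer.Properties as ℤ
import Data.Integer.Solver as ℤ-Solver
open import Data.Fin using (Fin; zero; suc)
open import Data.Fin.Subset
  using (Subset; inside; outside; _⊆_; _⊈_; _∩_; ∣_∣; ⊤; ⁅_⁆; Nonempty)
  renaming (⊥ to ∅; _∈_ to _∈ₛ_)
open import Data.Fin.Subset.Properties
  using ( ⊆-refl; ⊆-trans; ⊆-antisym; ⊆⊤; _⊆?_; drop-∷-⊆; in⊆in; out⊆; ∉⊥; x∈p∩q⁺; x∈p∩q⁻; ∩-comm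
        ; p⊆q⇒∣p∣≤∣q∣; ∣p∣≡n⇒p≡⊤; ∣⊤∣≡n; x∈⁅x⁆; x∈⁅y⁆⇒x≡y; ∣⁅x⁆∣≡1; Empty-unique)
  renaming (_∈?_ to _∈ₛ?_)
open import Data.Vec using ([]; _∷_; here; there)
import Data.Vec.Properties as Vec
open import Data.List using (List; []; _∷_; _++_; map; filter; length; foldr; concatMap; upTo; allFin; [_])
import Data.List.Properties as List
open import Data.List.Extrema ℕ.≤-totalOrder using (argmin; argmin-sel; f[argmin]≤f[xs])
open import Data.List.Membership.Propositional using (_∈_; _∉_; find)
open import Data.List.Membership.Propositional.Properties
  using ( ∈-map⁺; ∈-map⁻; ∈-++⁺ˡ; ∈-++⁺ʳ; ∈-++⁻; ∈-filter⁺; ∈-filter⁻; ∈-allFin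
        ; ∈-concatMap⁺; ∈-concatMap⁻; ∈-upTo⁻)
open import Data.List.Membership.Propositional.Properties.WithK using (unique∧set⇒bag)
open import Data.List.Relation.Unary.Any as Any using (here; there)
open import Data.List.Relation.Unary.All as All using ([]; _∷_)
import Data.List.Relation.Unary.All.Properties as All
open import Data.List.Relation.Unary.AllPairs as AllPairs using (AllPairs; []; _∷_; allPairs?)
import Data.List.Relation.Unary.AllPairs.Properties as AllPairs
open import Data.List.Relation.Unary.Unique.Propositional using (Unique)
open import Data.List.Relation.Unary.Unique.Propositional.Properties as Unique using (Unique[x∷xs]⇒x∉xs)
open import Data.List.Relation.Binary.Sublist.Propositional as Sublist
  using ([]; _∷_; _∷ʳ_) renaming (_⊆_ to _⊑_)
open import Data.List.Relation.Binary.Sublist.Propositional.Properties as Sublist using (filter-⊆)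
open import Data.List.Relation.Binary.Disjoint.Propositional using (Disjoint)
open import Data.List.Relation.Binary.BagAndSetEquality using (_∼[_]_; set; ∼bag⇒↭)
open import Data.List.Relation.Binary.Permutation.Propositional using (_↭_)
open import Data.List.Relation.Binary.Permutation.Propositional.Properties using (↭-length; filter-↭)
open import Relation.Binary.PropositionalEquality
  using (_≡_; _≢_; refl; sym; trans; cong; cong₂; subst; subst₂)
open import Relation.Binary.PropositionalEquality.Properties using (module ≡-Reasoning)
open import Relation.Nullary using (Dec; does; yes; no; ¬_; _⊎-dec_)
open import Relation.Nullary.Decidable using (dec-true; dec-false)
open import Relation.Unary using (Pred; Decidable)

private
  variable
    a p : Level
    A B : Set a
    x : A
    xs ys zs : List A
    n : ℕ
    s t : Bool
    S T v : Subset n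

∈-sublists⁺ : xs ⊑ ys → xs ∈ sublists ys
∈-sublists⁺ [] = here refl
∈-sublists⁺ {ys = y ∷ ys} (.y ∷ʳ p) = ∈-++⁺ʳ (map (y ∷_) (sublists ys)) (∈-sublists⁺ p)
∈-sublists⁺ (refl ∷ p) = ∈-++⁺ˡ (∈-map⁺ _ (∈-sublists⁺ p))

∈-sublists⁻ : ∀ ys → xs ∈ sublists ys → xs ⊑ ys
∈-sublists⁻ [] (here refl) = []
∈-sublists⁻ (y ∷ ys) p with ∈-++⁻ (map (y ∷_) (sublists ys)) p
... | inj₂ q = y ∷ʳ ∈-sublists⁻ ys q
... | inj₁ q with ∈-map⁻ (y ∷_) q
...   | _ , r , refl = refl ∷ ∈-sublists⁻ ys r

Unique-sublists : Unique xs → Unique (sublists xs)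
Unique-sublists [] = [] ∷ []
Unique-sublists {xs = x ∷ xs} u@(_ ∷ u′) =
  Unique.++⁺ (Unique.map⁺ List.∷-injectiveʳ (Unique-sublists u′)) (Unique-sublists u′) disjoint
  where
  disjoint : ∀ {σ} → ¬ (σ ∈ map (x ∷_) (sublists xs) × σ ∈ sublists xs)
  disjoint (p , q) with ∈-map⁻ (x ∷_) p
  ... | _ , _ , refl = Unique[x∷xs]⇒x∉xs u (Sublist.lookup (∈-sublists⁻ xs q) (here refl))

⊑-∼set⇒≡ : Unique zs → xs ⊑ zs → ys ⊑ zs → xs ∼[ set ] ys → xs ≡ ys
⊑-∼set⇒≡ _ [] [] _ = refl
⊑-∼set⇒≡ (_ ∷ u) (z ∷ʳ p) (.z ∷ʳ q) xs∼ys = ⊑-∼set⇒≡ u p q xs∼ys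
⊑-∼set⇒≡ u@(_ ∷ u′) (refl ∷ p) (refl ∷ q) xs∼ys =
  cong (_ ∷_) (⊑-∼set⇒≡ u′ p q (mk⇔ (tail p (to xs∼ys)) (tail q (from xs∼ys))))
  where
  open Equivalence
  tail : ∀ {ws vs} → ws ⊑ _ → (∀ {w} → w ∈ _ ∷ ws → w ∈ _ ∷ vs) → ∀ {w} → w ∈ ws → w ∈ vs
  tail r f w∈ws with f (there w∈ws)
  ... | there w∈vs = w∈vs
  ... | here refl = ⊥-elim (Unique[x∷xs]⇒x∉xs u (Sublist.lookup r w∈ws))
⊑-∼set⇒≡ u (refl ∷ p) (z ∷ʳ q) xs∼ys =
  ⊥-elim (Unique[x∷xs]⇒x∉xs u (Sublist.lookup q (Equivalence.to xs∼ys (here refl))))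
⊑-∼set⇒≡ u (z ∷ʳ p) (refl ∷ q) xs∼ys =
  ⊥-elim (Unique[x∷xs]⇒x∉xs u (Sublist.lookup p (Equivalence.from xs∼ys (here refl))))

Unique-map⁺-local : ∀ {f : A → B} → (∀ {x y} → x ∈ xs → y ∈ xs → f x ≡ f y → x ≡ y) →
                    Unique xs → Unique (map f xs)
Unique-map⁺-local _ [] = []
Unique-map⁺-local inj (x≢ ∷ u) =
  All.map⁺ (All.tabulate λ y∈ fx≡fy → All.lookup x≢ y∈ (inj (here refl) (there y∈) fx≡fy))
  ∷ Unique-map⁺-local (λ p q → inj (there p) (there q)) u

Unique-∷ : x ∉ xs → Unique xs → Unique (x ∷ xs)
Unique-∷ x∉xs u = All.¬Any⇒All¬ _ x∉xs ∷ u

⊑-Unique : xs ⊑ ys → Unique ys → Unique xs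
⊑-Unique [] [] = []
⊑-Unique (y ∷ʳ p) (_ ∷ u) = ⊑-Unique p u
⊑-Unique (refl ∷ p) (x≢ ∷ u) = Sublist.All-resp-⊆ p x≢ ∷ ⊑-Unique p u

does-true : ∀ {P : Set a} (P? : Dec P) → does P? ≡ true → P
does-true (yes p) _ = p

module _ {R : A → A → Set} (R-refl : ∀ {x} → R x x) (R-sym : ∀ {x y} → R x y → R y x) where

  allPairs⇒pairwise : ∀ {xs} → AllPairs R xs → ∀ {x y} → x ∈ xs → y ∈ xs → R x y
  allPairs⇒pairwise (_ ∷ _) (here refl) (here refl) = R-refl
  allPairs⇒pairwise (x≁ ∷ _) (here refl) (there y∈) = All.lookup x≁ y∈
  allPairs⇒pairwise (x≁ ∷ _) (there x∈) (here refl) = R-sym (All.lookup x≁ x∈)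
  allPairs⇒pairwise (_ ∷ rs) (there x∈) (there y∈) = allPairs⇒pairwise rs x∈ y∈

  pairwise⇒allPairs : ∀ xs → (∀ {x y} → x ∈ xs → y ∈ xs → R x y) → AllPairs R xs
  pairwise⇒allPairs [] _ = []
  pairwise⇒allPairs (x ∷ xs) r =
    All.tabulate (r (here refl) ∘ there) ∷ pairwise⇒allPairs xs (λ p q → r (there p) (there q))

module ListSum {c ℓ} (R : CommutativeSemiring c ℓ) where

  open CommutativeSemiring R renaming (refl to ≈-refl; sym to ≈-sym; trans to ≈-trans)
  open import Algebra.Properties.CommutativeSemigroup +-commutativeSemigroup using (interchange)
  open import Relation.Binary.Reasoning.Setoid setoid

  ∑ : List A → (A → Carrier) → Carrier
  ∑ xs f = foldr _+_ 0# (map f xs)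

  syntax ∑ xs (λ x → e) = ∑[ x ∈ xs ] e

  ∑-++ : ∀ xs ys (f : A → Carrier) → ∑ (xs ++ ys) f ≈ ∑ xs f + ∑ ys f
  ∑-++ [] ys f = ≈-sym (+-identityˡ _)
  ∑-++ (x ∷ xs) ys f = ≈-trans (+-congˡ (∑-++ xs ys f)) (≈-sym (+-assoc _ _ _))

  ∑-cong : ∀ xs {f g : A → Carrier} → (∀ {x} → x ∈ xs → f x ≈ g x) → ∑ xs f ≈ ∑ xs g
  ∑-cong [] _ = ≈-refl
  ∑-cong (x ∷ xs) f≈g = +-cong (f≈g (here refl)) (∑-cong xs (f≈g ∘ there))

  ∑-zero : ∀ (xs : List A) → ∑[ x ∈ xs ] 0# ≈ 0#
  ∑-zero [] = ≈-refl
  ∑-zero (x ∷ xs) = ≈-trans (+-congˡ (∑-zero xs)) (+-identityˡ 0#)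

  ∑-+ : ∀ xs (f g : A → Carrier) → ∑[ x ∈ xs ] (f x + g x) ≈ ∑ xs f + ∑ xs g
  ∑-+ [] f g = ≈-sym (+-identityˡ 0#)
  ∑-+ (x ∷ xs) f g = ≈-trans (+-congˡ (∑-+ xs f g)) (interchange _ _ _ _)

  ∑-*ˡ : ∀ c xs (f : A → Carrier) → ∑[ x ∈ xs ] (c * f x) ≈ c * ∑ xs f
  ∑-*ˡ c [] f = ≈-sym (zeroʳ c)
  ∑-*ˡ c (x ∷ xs) f = ≈-trans (+-congˡ (∑-*ˡ c xs f)) (≈-sym (distribˡ c _ _))

  ∑-*ʳ : ∀ c xs (f : A → Carrier) → ∑[ x ∈ xs ] (f x * c) ≈ ∑ xs f * c
  ∑-*ʳ c [] f = ≈-sym (zeroˡ c)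
  ∑-*ʳ c (x ∷ xs) f = ≈-trans (+-congˡ (∑-*ʳ c xs f)) (≈-sym (distribʳ c _ _))

  ∑-map : ∀ (h : B → A) xs f → ∑ (map h xs) f ≡ ∑ xs (f ∘ h)
  ∑-map h xs f = cong (foldr _+_ 0#) (sym (List.map-∘ xs))

  ∑-concatMap : ∀ (g : B → List A) xs f → ∑ (concatMap g xs) f ≈ ∑[ y ∈ xs ] ∑ (g y) f
  ∑-concatMap g [] f = ≈-refl
  ∑-concatMap g (y ∷ ys) f = ≈-trans (∑-++ (g y) (concatMap g ys) f) (+-congˡ (∑-concatMap g ys f))

  ∑-upTo-last : ∀ k f → ∑ (upTo (suc k)) f ≈ ∑ (upTo k) f + f k
  ∑-upTo-last k f = begin
    ∑ (upTo (suc k)) f          ≡⟨ cong (λ is → ∑ is f) (sym (List.upTo-∷ʳ k)) ⟩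
    ∑ (upTo k ++ [ k ]) f       ≈⟨ ∑-++ (upTo k) [ k ] f ⟩
    ∑ (upTo k) f + (f k + 0#)   ≈⟨ +-congˡ (+-identityʳ (f k)) ⟩
    ∑ (upTo k) f + f k          ∎

  ∑-upTo-first : ∀ k f → ∑ (upTo (suc k)) f ≡ f 0 + ∑ (upTo k) (f ∘ suc)
  ∑-upTo-first k f = cong (λ xs → f 0 + foldr _+_ 0# xs)
    (trans (List.map-applyUpTo suc f k) (sym (List.map-upTo (f ∘ suc) k)))

χ : ∀ {P : Set p} → Dec P → ℕ
χ P? = if does P? then 1 else 0

χ-*-cong : ∀ {P : Set p} (P? : Dec P) {x y} → (P → x ≡ y) → χ P? ℕ.* x ≡ χ P? ℕ.* y
χ-*-cong (yes p) x≡y = cong (1 ℕ.*_) (x≡y p)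
χ-*-cong (no _) _ = refl

module ℕ-Sum where

  open ListSum ℕ.+-*-commutativeSemiring public

  length-filter≡∑χ : ∀ {P : Pred A p} (P? : Decidable P) xs → length (filter P? xs) ≡ ∑ xs (χ ∘ P?)
  length-filter≡∑χ P? [] = refl
  length-filter≡∑χ P? (x ∷ xs) with does (P? x)
  ... | true = cong suc (length-filter≡∑χ P? xs)
  ... | false = length-filter≡∑χ P? xs

  ∑-const : ∀ (xs : List A) c → ∑ xs (λ _ → c) ≡ c ℕ.* length xs
  ∑-const [] c = sym (ℕ.*-zeroʳ c)
  ∑-const (x ∷ xs) c = trans (cong (c ℕ.+_) (∑-const xs c)) (sym (ℕ.*-suc c (length xs)))

  F≡∑χ : ∀ m j → F m j ≡ ∑[ σ ∈ faces m ] χ (length σ ℕ.≟ j)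
  F≡∑χ m j = length-filter≡∑χ (λ σ → length σ ℕ.≟ j) (faces m)

open ≡-Reasoning

∈-allSubsets : ∀ (S : Subset n) → S ∈ allSubsets n
∈-allSubsets [] = here refl
∈-allSubsets {suc n} (inside ∷ S) = ∈-++⁺ˡ (∈-map⁺ (inside ∷_) (∈-allSubsets S))
∈-allSubsets {suc n} (outside ∷ S) =
  ∈-++⁺ʳ (map (inside ∷_) (allSubsets n)) (∈-map⁺ (outside ∷_) (∈-allSubsets S))

Unique-allSubsets : ∀ n → Unique (allSubsets n)
Unique-allSubsets zero = [] ∷ []
Unique-allSubsets (suc n) = Unique.++⁺ (Unique.map⁺ Vec.∷-injectiveʳ (Unique-allSubsets n))
                                       (Unique.map⁺ Vec.∷-injectiveʳ (Unique-allSubsets n)) heads-differ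
  where
  heads-differ : ∀ {S} → ¬ (S ∈ map (inside ∷_) (allSubsets n) × S ∈ map (outside ∷_) (allSubsets n))
  heads-differ (p , q) with ∈-map⁻ _ p | ∈-map⁻ _ q
  ... | _ , _ , refl | _ , _ , ()

p⊆q∧∣q∣≤∣p∣⇒p≡q : S ⊆ T → ∣ T ∣ ≤ ∣ S ∣ → S ≡ T
p⊆q∧∣q∣≤∣p∣⇒p≡q {S = []} {[]} _ _ = refl
p⊆q∧∣q∣≤∣p∣⇒p≡q {S = inside ∷ S} {inside ∷ T} S⊆T (s≤s ∣T∣≤∣S∣) =
  cong (inside ∷_) (p⊆q∧∣q∣≤∣p∣⇒p≡q (drop-∷-⊆ S⊆T) ∣T∣≤∣S∣)
p⊆q∧∣q∣≤∣p∣⇒p≡q {S = outside ∷ S} {outside ∷ T} S⊆T ∣T∣≤∣S∣ =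
  cong (outside ∷_) (p⊆q∧∣q∣≤∣p∣⇒p≡q (drop-∷-⊆ S⊆T) ∣T∣≤∣S∣)
p⊆q∧∣q∣≤∣p∣⇒p≡q {S = inside ∷ S} {outside ∷ T} S⊆T _ with S⊆T here
... | ()
p⊆q∧∣q∣≤∣p∣⇒p≡q {S = outside ∷ S} {inside ∷ T} S⊆T ∣T∣≤∣S∣ =
  ⊥-elim (ℕ.<⇒≱ (s≤s (p⊆q⇒∣p∣≤∣q∣ (drop-∷-⊆ S⊆T))) ∣T∣≤∣S∣)

∣p∣≡0⇒p≡∅ : ∀ (S : Subset n) → ∣ S ∣ ≡ 0 → S ≡ ∅
∣p∣≡0⇒p≡∅ [] _ = refl
∣p∣≡0⇒p≡∅ (outside ∷ S) ∣S∣≡0 = cong (outside ∷_) (∣p∣≡0⇒p≡∅ S ∣S∣≡0)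

∣p∣≡1⇒p≡⁅x⁆ : ∀ (S : Subset n) → ∣ S ∣ ≡ 1 → ∃[ i ] S ≡ ⁅ i ⁆
∣p∣≡1⇒p≡⁅x⁆ (inside ∷ S) ∣S∣+1≡1 = zero , cong (inside ∷_) (∣p∣≡0⇒p≡∅ S (ℕ.suc-injective ∣S∣+1≡1))
∣p∣≡1⇒p≡⁅x⁆ (outside ∷ S) ∣S∣≡1 with ∣p∣≡1⇒p≡⁅x⁆ S ∣S∣≡1
... | i , refl = suc i , refl

1≤∣p∣⇒Nonempty : ∀ (S : Subset n) → 1 ≤ ∣ S ∣ → Nonempty S
1≤∣p∣⇒Nonempty (inside ∷ S) _ = zero , here
1≤∣p∣⇒Nonempty (outside ∷ S) 1≤∣S∣ = let i , i∈S = 1≤∣p∣⇒Nonempty S 1≤∣S∣ in suc i , there i∈S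

Pairwise : List (Subset n) → Set
Pairwise σ = ∀ {S T} → S ∈ σ → T ∈ σ → Compatible S T

compatible-refl : Compatible S S
compatible-refl = inj₁ ⊆-refl

compatible-sym : Compatible S T → Compatible T S
compatible-sym (inj₁ S⊆T) = inj₂ (inj₁ S⊆T)
compatible-sym (inj₂ (inj₁ T⊆S)) = inj₁ T⊆S
compatible-sym {S = S} {T} (inj₂ (inj₂ S∩T≡∅)) = inj₂ (inj₂ (trans (∩-comm T S) S∩T≡∅))

compatible-tail : Compatible (s ∷ S) (t ∷ T) → Compatible S T
compatible-tail (inj₁ S⊆T) = inj₁ (drop-∷-⊆ S⊆T)
compatible-tail (inj₂ (inj₁ T⊆S)) = inj₂ (inj₁ (drop-∷-⊆ T⊆S))
compatible-tail (inj₂ (inj₂ S∩T≡∅)) = inj₂ (inj₂ (Vec.∷-injectiveʳ S∩T≡∅))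

inside-inside-compatible⁻ : Compatible (inside ∷ S) (inside ∷ T) → S ⊆ T ⊎ T ⊆ S
inside-inside-compatible⁻ (inj₁ S⊆T) = inj₁ (drop-∷-⊆ S⊆T)
inside-inside-compatible⁻ (inj₂ (inj₁ T⊆S)) = inj₂ (drop-∷-⊆ T⊆S)

inside-outside-compatible⁻ : Compatible (inside ∷ S) (outside ∷ T) → T ⊆ S ⊎ S ∩ T ≡ ∅
inside-outside-compatible⁻ (inj₁ S⊆T) with S⊆T here
... | ()
inside-outside-compatible⁻ (inj₂ (inj₁ T⊆S)) = inj₁ (drop-∷-⊆ T⊆S)
inside-outside-compatible⁻ (inj₂ (inj₂ S∩T≡∅)) = inj₂ (Vec.∷-injectiveʳ S∩T≡∅)

Nonempty-⊆⇒∩≢∅ : Nonempty v → v ⊆ S → v ⊆ T → S ∩ T ≢ ∅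
Nonempty-⊆⇒∩≢∅ (x , x∈v) v⊆S v⊆T S∩T≡∅ = ∉⊥ (subst (x ∈ₛ_) S∩T≡∅ (x∈p∩q⁺ (v⊆S x∈v , v⊆T x∈v)))

⁅⁆-compatible : ∀ i (T : Subset n) → Compatible ⁅ i ⁆ T
⁅⁆-compatible i T with i ∈ₛ? T
... | yes i∈T = inj₁ λ x∈⁅i⁆ → subst (_∈ₛ T) (sym (x∈⁅y⁆⇒x≡y i x∈⁅i⁆)) i∈T
... | no i∉T = inj₂ (inj₂ (Empty-unique λ (x , x∈⁅i⁆∩T) →
  let x∈⁅i⁆ , x∈T = x∈p∩q⁻ ⁅ i ⁆ T x∈⁅i⁆∩T in i∉T (subst (_∈ₛ T) (x∈⁅y⁆⇒x≡y i x∈⁅i⁆) x∈T)))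

data Lifted (v : Subset n) : Subset (suc n) → Set where
  raised : v ⊆ S → Lifted v (inside ∷ S)
  kept   : (v ⊆ S → S ≡ v) → Lifted v (outside ∷ S)

raised-kept-compatible : Compatible S T → v ⊆ S → (v ⊆ T → T ≡ v) →
                         Compatible (inside ∷ S) (outside ∷ T)
raised-kept-compatible (inj₁ S⊆T) v⊆S T≡v =
  inj₂ (inj₁ (out⊆ (subst (_⊆ _) (sym (T≡v (⊆-trans v⊆S S⊆T))) v⊆S)))
raised-kept-compatible (inj₂ (inj₁ T⊆S)) _ _ = inj₂ (inj₁ (out⊆ T⊆S))
raised-kept-compatible (inj₂ (inj₂ S∩T≡∅)) _ _ = inj₂ (inj₂ (cong (outside ∷_) S∩T≡∅))

lifted-compatible : Nonempty v → Compatible S T →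
                    Lifted v (s ∷ S) → Lifted v (t ∷ T) → Compatible (s ∷ S) (t ∷ T)
lifted-compatible ne (inj₁ S⊆T) (raised v⊆S) (raised v⊆T) = inj₁ (in⊆in S⊆T)
lifted-compatible ne (inj₂ (inj₁ T⊆S)) (raised v⊆S) (raised v⊆T) = inj₂ (inj₁ (in⊆in T⊆S))
lifted-compatible ne (inj₂ (inj₂ S∩T≡∅)) (raised v⊆S) (raised v⊆T) =
  ⊥-elim (Nonempty-⊆⇒∩≢∅ ne v⊆S v⊆T S∩T≡∅)
lifted-compatible ne c (raised v⊆S) (kept T≡v) = raised-kept-compatible c v⊆S T≡v
lifted-compatible ne c (kept S≡v) (raised v⊆T) =
  compatible-sym (raised-kept-compatible (compatible-sym c) v⊆T S≡v)
lifted-compatible ne (inj₁ S⊆T) (kept _) (kept _) = inj₁ (out⊆ S⊆T)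
lifted-compatible ne (inj₂ (inj₁ T⊆S)) (kept _) (kept _) = inj₂ (inj₁ (out⊆ T⊆S))
lifted-compatible ne (inj₂ (inj₂ S∩T≡∅)) (kept _) (kept _) = inj₂ (inj₂ (cong (outside ∷_) S∩T≡∅))

module Complex (m : ℕ) where

  ∈-vertices⁺ : ∀ {S} → IsVertex m S → S ∈ vertices m
  ∈-vertices⁺ {S} = ∈-filter⁺ (isVertex? m) (∈-allSubsets S)

  ∈-vertices⁻ : ∀ {S} → S ∈ vertices m → IsVertex m S
  ∈-vertices⁻ S∈V = proj₂ (∈-filter⁻ (isVertex? m) {xs = allSubsets (Ground m)} S∈V)

  Unique-vertices : Unique (vertices m)
  Unique-vertices = Unique.filter⁺ (isVertex? m) (Unique-allSubsets (Ground m))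

  Unique-faces : Unique (faces m)
  Unique-faces = Unique.filter⁺ (allPairs? compatible?) (Unique-sublists Unique-vertices)

  ∈-faces⁺ : ∀ {σ} → σ ⊑ vertices m → Pairwise σ → σ ∈ faces m
  ∈-faces⁺ {σ} σ⊑V pw = ∈-filter⁺ (allPairs? compatible?) (∈-sublists⁺ σ⊑V)
    (pairwise⇒allPairs compatible-refl compatible-sym σ pw)

  face-⊑ : ∀ {σ} → σ ∈ faces m → σ ⊑ vertices m
  face-⊑ σ∈F = ∈-sublists⁻ (vertices m)
    (proj₁ (∈-filter⁻ (allPairs? compatible?) {xs = sublists (vertices m)} σ∈F))

  face-pairwise : ∀ {σ} → σ ∈ faces m → Pairwise σ
  face-pairwise σ∈F = allPairs⇒pairwise compatible-refl compatible-sym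
    (proj₂ (∈-filter⁻ (allPairs? compatible?) {xs = sublists (vertices m)} σ∈F))

  face-Unique : ∀ {σ} → σ ∈ faces m → Unique σ
  face-Unique σ∈F = ⊑-Unique (face-⊑ σ∈F) Unique-vertices

  face-vertex : ∀ {σ S} → σ ∈ faces m → S ∈ σ → IsVertex m S
  face-vertex σ∈F S∈σ = ∈-vertices⁻ (Sublist.lookup (face-⊑ σ∈F) S∈σ)

_≟ₛ_ : ∀ {k} (S T : Subset k) → Dec (S ≡ T)
_≟ₛ_ = Vec.≡-dec Bool._≟_


module Step (n : ℕ) where

  open import Data.Nat using (_+_; _*_; _≟_)
  open ℕ-Sum
  open import Data.List.Membership.DecPropositional (_≟ₛ_ {3 + n}) using (_∈?_)

  module Δ₀ = Complex (3 + n)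
  module Δ₁ = Complex (4 + n)

  private
    variable
      b b′ : Bool
      v′ : Subset (2 + n)
      τ τ′ : List (Subset (2 + n))

  ∣⊤∣≡2+n : ∣ ⊤ {2 + n} ∣ ≡ 2 + n
  ∣⊤∣≡2+n = ∣⊤∣≡n (2 + n)

  raise-vertex : IsVertex (3 + n) S → IsVertex (4 + n) (inside ∷ S)
  raise-vertex (2≤∣S∣ , ∣S∣≤1+n) = ℕ.m≤n⇒m≤1+n 2≤∣S∣ , s≤s ∣S∣≤1+n

  keep-vertex : IsVertex (3 + n) S → IsVertex (4 + n) (outside ∷ S)
  keep-vertex (2≤∣S∣ , ∣S∣≤1+n) = 2≤∣S∣ , ℕ.m≤n⇒m≤1+n ∣S∣≤1+n

  ⊤-not-vertex : ¬ IsVertex (3 + n) ⊤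
  ⊤-not-vertex (_ , ∣⊤∣≤1+n) = ℕ.<⇒≱ (ℕ.≤-reflexive (sym ∣⊤∣≡2+n)) ∣⊤∣≤1+n

  ⁅⁆-not-vertex : ∀ i → ¬ IsVertex (3 + n) ⁅ i ⁆
  ⁅⁆-not-vertex i (2≤∣⁅i⁆∣ , _) = ℕ.<-irrefl refl (ℕ.≤-trans 2≤∣⁅i⁆∣ (ℕ.≤-reflexive (∣⁅x⁆∣≡1 i)))

  ⊤≢⁅⁆ : ∀ (i : Fin (2 + n)) → ⊤ ≢ ⁅ i ⁆
  ⊤≢⁅⁆ i ⊤≡⁅i⁆ = ℕ.1+n≢0 (ℕ.suc-injective (trans (sym ∣⊤∣≡2+n) (trans (cong ∣_∣ ⊤≡⁅i⁆) (∣⁅x⁆∣≡1 i))))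

  ⁅⁆-injective : ∀ {i j : Fin (2 + n)} → ⁅ i ⁆ ≡ ⁅ j ⁆ → i ≡ j
  ⁅⁆-injective {i} {j} ⁅i⁆≡⁅j⁆ = x∈⁅y⁆⇒x≡y j (subst (i ∈ₛ_) ⁅i⁆≡⁅j⁆ (x∈⁅x⁆ i))

  data Centre (τ : List (Subset (2 + n))) : Subset (2 + n) → Bool → Set where
    member : v ∈ τ → Centre τ v b
    whole  : Centre τ ⊤ b
    point  : ∀ i → Centre τ ⁅ i ⁆ true

  points : List (Subset (2 + n))
  points = map ⁅_⁆ (allFin (2 + n))

  centres : List (Subset (2 + n)) → Bool → List (Subset (2 + n))
  centres τ false = ⊤ ∷ τ
  centres τ true  = ⊤ ∷ τ ++ points

  ∈-centres⁺ : Centre τ v b → v ∈ centres τ b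
  ∈-centres⁺ {b = false} (member v∈τ) = there v∈τ
  ∈-centres⁺ {b = true}  (member v∈τ) = there (∈-++⁺ˡ v∈τ)
  ∈-centres⁺ {b = false} whole = here refl
  ∈-centres⁺ {b = true}  whole = here refl
  ∈-centres⁺ {τ = τ} (point i) = there (∈-++⁺ʳ τ (∈-map⁺ ⁅_⁆ (∈-allFin i)))

  ∈-points⁻ : S ∈ points → ∃[ i ] S ≡ ⁅ i ⁆
  ∈-points⁻ S∈ = let i , _ , S≡⁅i⁆ = ∈-map⁻ ⁅_⁆ {xs = allFin (2 + n)} S∈ in i , S≡⁅i⁆

  ∈-centres⁻ : ∀ b → v ∈ centres τ b → Centre τ v b
  ∈-centres⁻ false (here refl) = whole
  ∈-centres⁻ false (there v∈τ) = member v∈τ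
  ∈-centres⁻ true (here refl) = whole
  ∈-centres⁻ {τ = τ} true (there v∈) with ∈-++⁻ τ v∈
  ... | inj₁ v∈τ = member v∈τ
  ... | inj₂ v∈points with ∈-points⁻ v∈points
  ...   | i , refl = point i

  Unique-centres : τ ∈ faces (3 + n) → ∀ b → Unique (centres τ b)
  Unique-centres {τ} τ∈F false = Unique-∷ (⊤-not-vertex ∘ Δ₀.face-vertex τ∈F) (Δ₀.face-Unique τ∈F)
  Unique-centres {τ} τ∈F true = Unique-∷ ⊤∉τ++points
    (Unique.++⁺ (Δ₀.face-Unique τ∈F) (Unique.map⁺ ⁅⁆-injective (Unique.allFin⁺ (2 + n))) points∉τ)
    where
    ⊤∉τ++points : ⊤ ∉ τ ++ points
    ⊤∉τ++points ⊤∈ with ∈-++⁻ τ ⊤∈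
    ... | inj₁ ⊤∈τ = ⊤-not-vertex (Δ₀.face-vertex τ∈F ⊤∈τ)
    ... | inj₂ ⊤∈points = let i , ⊤≡⁅i⁆ = ∈-points⁻ ⊤∈points in ⊤≢⁅⁆ i ⊤≡⁅i⁆
    points∉τ : ∀ {S} → ¬ (S ∈ τ × S ∈ points)
    points∉τ (S∈τ , S∈points) with ∈-points⁻ S∈points
    ... | i , refl = ⁅⁆-not-vertex i (Δ₀.face-vertex τ∈F S∈τ)

  -- The extra ground element x of Δ_{4+n} is the head coordinate: inside ∷ S is S ∪ {x}.
  lift : Subset (2 + n) → Subset (2 + n) → Subset (3 + n)
  lift v T = does (v ⊆? T) ∷ T

  -- v itself, or v ∪ {x} when v is a singleton (which is not a vertex).
  newVertex : Subset (2 + n) → Subset (3 + n)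
  newVertex v = does (∣ v ∣ ≟ 1) ∷ v

  lift-⊆ : v ⊆ T → lift v T ≡ inside ∷ T
  lift-⊆ {v} {T} v⊆T = cong (_∷ T) (dec-true (v ⊆? T) v⊆T)

  lift-⊈ : v ⊈ T → lift v T ≡ outside ∷ T
  lift-⊈ {v} {T} v⊈T = cong (_∷ T) (dec-false (v ⊆? T) v⊈T)

  lift-∈ : ∀ {xs} → (v ⊆ T → (inside ∷ T) ∈ xs) → (v ⊈ T → (outside ∷ T) ∈ xs) → lift v T ∈ xs
  lift-∈ {v} {T} raised∈ kept∈ with v ⊆? T
  ... | yes v⊆T = raised∈ v⊆T
  ... | no v⊈T = kept∈ v⊈T

  lift-lifted : ∀ v T → Lifted v (lift v T)
  lift-lifted v T with v ⊆? T
  ... | yes v⊆T = raised v⊆T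
  ... | no v⊈T = kept (⊥-elim ∘ v⊈T)

  lift-vertex : ∀ v → IsVertex (3 + n) T → IsVertex (4 + n) (lift v T)
  lift-vertex {T} v T-vertex with v ⊆? T
  ... | yes _ = raise-vertex {T} T-vertex
  ... | no _ = keep-vertex {T} T-vertex

  newVertex-∣∣≡1 : ∣ v ∣ ≡ 1 → newVertex v ≡ inside ∷ v
  newVertex-∣∣≡1 {v} ∣v∣≡1 = cong (_∷ v) (dec-true (∣ v ∣ ≟ 1) ∣v∣≡1)

  newVertex-2≤∣∣ : 2 ≤ ∣ v ∣ → newVertex v ≡ outside ∷ v
  newVertex-2≤∣∣ {v} 2≤∣v∣ = cong (_∷ v) (dec-false (∣ v ∣ ≟ 1) ∣v∣≢1)
    where ∣v∣≢1 = λ ∣v∣≡1 → ℕ.<-irrefl refl (ℕ.≤-trans 2≤∣v∣ (ℕ.≤-reflexive ∣v∣≡1))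

  newVertex-lifted : ∀ v → Lifted v (newVertex v)
  newVertex-lifted v with ∣ v ∣ ≟ 1
  ... | yes ∣v∣≡1 = subst (Lifted v) (sym (newVertex-∣∣≡1 {v} ∣v∣≡1)) (raised ⊆-refl)
  ... | no ∣v∣≢1 = subst (Lifted v) (sym (cong (_∷ v) (dec-false (∣ v ∣ ≟ 1) ∣v∣≢1))) (kept (λ _ → refl))

  extension : List (Subset (2 + n)) → Subset (2 + n) → Bool → List (Subset (3 + n))
  extension τ v false = map (lift v) τ
  extension τ v true  = newVertex v ∷ map (lift v) τ

  -- Faces are listed in the order of `vertices`; the filter puts `extension` into that form.
  extend : List (Subset (2 + n)) → Subset (2 + n) → Bool → List (Subset (3 + n))
  extend τ v b = filter (_∈? extension τ v b) (vertices (4 + n))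

  ∈-extension⁻ : ∀ b → x ∈ extension τ v b → (∃[ T ] T ∈ τ × x ≡ lift v T) ⊎ (b ≡ true × x ≡ newVertex v)
  ∈-extension⁻ false x∈ = inj₁ (∈-map⁻ _ x∈)
  ∈-extension⁻ true (here refl) = inj₂ (refl , refl)
  ∈-extension⁻ true (there x∈) = inj₁ (∈-map⁻ _ x∈)

  lift-∈-extension : ∀ b → T ∈ τ → lift v T ∈ extension τ v b
  lift-∈-extension false = ∈-map⁺ _
  lift-∈-extension true = there ∘ ∈-map⁺ _

  extension-lifted : ∀ b → (s ∷ S) ∈ extension τ v b → S ∈ v ∷ τ × Lifted v (s ∷ S)
  extension-lifted {v = v} b x∈ with ∈-extension⁻ b x∈
  ... | inj₁ (T , T∈τ , refl) = there T∈τ , lift-lifted v T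
  ... | inj₂ (_ , refl) = here refl , newVertex-lifted v

  length-extension : ∀ τ v b → length (extension τ v b) ≡ (if b then suc (length τ) else length τ)
  length-extension τ v false = List.length-map (lift v) τ
  length-extension τ v true = cong suc (List.length-map (lift v) τ)

  raised-⊇-centre : ∀ b → (inside ∷ S) ∈ extension τ v b → v ⊆ S
  raised-⊇-centre b x∈ with extension-lifted b x∈
  ... | _ , raised v⊆S = v⊆S

  module _ (τ∈F : τ ∈ faces (3 + n)) where

    centre-nonempty : Centre τ v b → Nonempty v
    centre-nonempty {v} (member v∈τ) =
      1≤∣p∣⇒Nonempty v (ℕ.≤-trans (s≤s z≤n) (proj₁ (Δ₀.face-vertex τ∈F v∈τ)))
    centre-nonempty whole = zero , here
    centre-nonempty (point i) = i , x∈⁅x⁆ i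

    centre-compatible : Centre τ v b → T ∈ τ → Compatible v T
    centre-compatible (member v∈τ) T∈τ = Δ₀.face-pairwise τ∈F v∈τ T∈τ
    centre-compatible whole _ = inj₂ (inj₁ ⊆⊤)
    centre-compatible {T = T} (point i) _ = ⁅⁆-compatible i T

    centre-pairwise : Centre τ v b → Pairwise (v ∷ τ)
    centre-pairwise c (here refl) (here refl) = compatible-refl
    centre-pairwise c (here refl) (there T∈τ) = centre-compatible c T∈τ
    centre-pairwise c (there S∈τ) (here refl) = compatible-sym (centre-compatible c S∈τ)
    centre-pairwise c (there S∈τ) (there T∈τ) = Δ₀.face-pairwise τ∈F S∈τ T∈τ

    newVertex-vertex : Centre τ v true → IsVertex (4 + n) (newVertex v)
    newVertex-vertex {v} (member v∈τ) =
      subst (IsVertex (4 + n)) (sym (newVertex-2≤∣∣ {v} (proj₁ v-vertex))) (keep-vertex {v} v-vertex)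
      where v-vertex = Δ₀.face-vertex τ∈F v∈τ
    newVertex-vertex whole = subst (IsVertex (4 + n)) (sym (newVertex-2≤∣∣ {⊤} (proj₁ ⊤-vertex))) ⊤-vertex
      where
      ⊤-vertex : IsVertex (4 + n) (outside ∷ ⊤)
      ⊤-vertex = subst (λ k → 2 ≤ k × k ≤ 2 + n) (sym ∣⊤∣≡2+n) (s≤s (s≤s z≤n) , ℕ.≤-refl)
    newVertex-vertex (point i) = subst (IsVertex (4 + n)) (sym (newVertex-∣∣≡1 {⁅ i ⁆} ∣⁅x⁆∣≡1i))
      (subst (λ k → 2 ≤ suc k × suc k ≤ 2 + n) (sym ∣⁅x⁆∣≡1i) (s≤s (s≤s z≤n) , s≤s (s≤s z≤n)))
      where ∣⁅x⁆∣≡1i = ∣⁅x⁆∣≡1 i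

    extension-vertex : Centre τ v b → x ∈ extension τ v b → IsVertex (4 + n) x
    extension-vertex {v} {b} c x∈ with ∈-extension⁻ b x∈
    ... | inj₁ (T , T∈τ , refl) = lift-vertex v (Δ₀.face-vertex τ∈F T∈τ)
    ... | inj₂ (refl , refl) = newVertex-vertex c

    extend∼extension : Centre τ v b → extend τ v b ∼[ set ] extension τ v b
    extend∼extension {v} {b} c = mk⇔
      (λ x∈ → proj₂ (∈-filter⁻ (_∈? extension τ v b) {xs = vertices (4 + n)} x∈))
      (λ x∈ → ∈-filter⁺ (_∈? extension τ v b) (Δ₁.∈-vertices⁺ (extension-vertex c x∈)) x∈)

    extend-face : Centre τ v b → extend τ v b ∈ faces (4 + n)
    extend-face {v} {b} c = Δ₁.∈-faces⁺ (filter-⊆ (_∈? extension τ v b) (vertices (4 + n))) pairwise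
      where
      pairwise : Pairwise (extend τ v b)
      pairwise {s ∷ S} {t ∷ T} x∈ y∈ with extension-lifted b (Equivalence.to (extend∼extension c) x∈)
                                         | extension-lifted b (Equivalence.to (extend∼extension c) y∈)
      ... | S∈ , S-lifted | T∈ , T-lifted =
        lifted-compatible (centre-nonempty c) (centre-pairwise c S∈ T∈) S-lifted T-lifted

    extension-tail : Centre τ v b → IsVertex (3 + n) T → (s ∷ T) ∈ extension τ v b → T ∈ τ
    extension-tail {b = b} c T-vertex x∈ with ∈-extension⁻ b x∈ | c
    ... | inj₁ (_ , T′∈τ , refl) | _ = T′∈τ
    ... | inj₂ (_ , refl) | member v∈τ = v∈τ
    ... | inj₂ (_ , refl) | whole = ⊥-elim (⊤-not-vertex T-vertex)
    ... | inj₂ (_ , refl) | point i = ⊥-elim (⁅⁆-not-vertex i T-vertex)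

    centre-raised : Centre τ v b → v ≢ ⊤ → (inside ∷ v) ∈ extension τ v b
    centre-raised {v} {b} (member v∈τ) _ =
      subst (_∈ extension τ v b) (lift-⊆ {v} ⊆-refl) (lift-∈-extension b v∈τ)
    centre-raised whole ⊤≢⊤ = ⊥-elim (⊤≢⊤ refl)
    centre-raised (point i) _ =
      subst (_∈ extension τ ⁅ i ⁆ true) (newVertex-∣∣≡1 {⁅ i ⁆} (∣⁅x⁆∣≡1 i)) (here refl)

    newVertex-∉-lifts : Centre τ v true → newVertex v ∉ map (lift v) τ
    newVertex-∉-lifts {v} c newVertex∈ with ∈-map⁻ (lift v) newVertex∈
    ... | T , T∈τ , e with Vec.∷-injectiveʳ e | c
    ... | refl | member v∈τ with () ← Vec.∷-injectiveˡ
          (trans (sym (newVertex-2≤∣∣ {v} (proj₁ (Δ₀.face-vertex τ∈F v∈τ)))) (trans e (lift-⊆ {v} ⊆-refl)))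
    ... | refl | whole = ⊤-not-vertex (Δ₀.face-vertex τ∈F T∈τ)
    ... | refl | point i = ⁅⁆-not-vertex i (Δ₀.face-vertex τ∈F T∈τ)

    Unique-extension : Centre τ v b → Unique (extension τ v b)
    Unique-extension {b = false} c = Unique.map⁺ Vec.∷-injectiveʳ (Δ₀.face-Unique τ∈F)
    Unique-extension {b = true} c =
      Unique-∷ (newVertex-∉-lifts c) (Unique.map⁺ Vec.∷-injectiveʳ (Δ₀.face-Unique τ∈F))

    length-extend : Centre τ v b → length (extend τ v b) ≡ length (extension τ v b)
    length-extend c = ↭-length (∼bag⇒↭ (unique∧set⇒bag
      (Unique.filter⁺ _ Δ₁.Unique-vertices) (Unique-extension c) (extend∼extension c)))

  lifts-determine-face : τ ∈ faces (3 + n) → τ′ ∈ faces (3 + n) → Centre τ′ v′ b′ →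
                         (∀ {x} → x ∈ extension τ v b → x ∈ extension τ′ v′ b′) → T ∈ τ → T ∈ τ′
  lifts-determine-face {b = b} τ∈F τ′∈F c′ ext⊆ext′ T∈τ =
    extension-tail τ′∈F c′ (Δ₀.face-vertex τ∈F T∈τ) (ext⊆ext′ (lift-∈-extension b T∈τ))

  lifts-bound-centre : τ′ ∈ faces (3 + n) → Centre τ′ v′ b′ →
                       (∀ {x} → x ∈ extension τ′ v′ b′ → x ∈ extension τ v b) → v ⊆ v′
  lifts-bound-centre {v′ = v′} {b = b} τ′∈F c′ ext′⊆ext with v′ ≟ₛ ⊤
  ... | yes refl = ⊆⊤
  ... | no v′≢⊤ = raised-⊇-centre b (ext′⊆ext (centre-raised τ′∈F c′ v′≢⊤))

  private
    suc-if-injective : ∀ m b b′ → (if b then suc m else m) ≡ (if b′ then suc m else m) → b ≡ b′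
    suc-if-injective m true true _ = refl
    suc-if-injective m false false _ = refl
    suc-if-injective m true false e = ⊥-elim (ℕ.1+n≢n e)
    suc-if-injective m false true e = ⊥-elim (ℕ.1+n≢n (sym e))

  extend-injective : τ ∈ faces (3 + n) → Centre τ v b → τ′ ∈ faces (3 + n) → Centre τ′ v′ b′ →
                     extend τ v b ≡ extend τ′ v′ b′ → (τ , v , b) ≡ (τ′ , v′ , b′)
  extend-injective {τ} {v} {b} {τ′} {v′} {b′} τ∈F c τ′∈F c′ e = cong₂ _,_ τ≡τ′ (cong₂ _,_ v≡v′ b≡b′)
    where
    ext→ext′ : ∀ {x} → x ∈ extension τ v b → x ∈ extension τ′ v′ b′
    ext→ext′ = Equivalence.to (extend∼extension τ′∈F c′) ∘ subst (_ ∈_) e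
             ∘ Equivalence.from (extend∼extension τ∈F c)
    ext′→ext : ∀ {x} → x ∈ extension τ′ v′ b′ → x ∈ extension τ v b
    ext′→ext = Equivalence.to (extend∼extension τ∈F c) ∘ subst (_ ∈_) (sym e)
             ∘ Equivalence.from (extend∼extension τ′∈F c′)
    τ≡τ′ : τ ≡ τ′
    τ≡τ′ = ⊑-∼set⇒≡ Δ₀.Unique-vertices (Δ₀.face-⊑ τ∈F) (Δ₀.face-⊑ τ′∈F)
      (mk⇔ (lifts-determine-face {v = v} {b} τ∈F τ′∈F c′ ext→ext′)
           (lifts-determine-face {v = v′} {b′} τ′∈F τ∈F c ext′→ext))
    v≡v′ : v ≡ v′
    v≡v′ = ⊆-antisym (lifts-bound-centre {τ = τ} {b = b} τ′∈F c′ ext′→ext)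
                     (lifts-bound-centre {τ = τ′} {b = b′} τ∈F c ext→ext′)
    b≡b′ : b ≡ b′
    b≡b′ = suc-if-injective (length τ) b b′ (begin
      (if b then suc (length τ) else length τ)      ≡⟨ sym (length-extension τ v b) ⟩
      length (extension τ v b)                      ≡⟨ sym (length-extend τ∈F c) ⟩
      length (extend τ v b)                         ≡⟨ cong length e ⟩
      length (extend τ′ v′ b′)                      ≡⟨ length-extend τ′∈F c′ ⟩
      length (extension τ′ v′ b′)                   ≡⟨ length-extension τ′ v′ b′ ⟩
      (if b′ then suc (length τ′) else length τ′)   ≡⟨ cong (λ σ → if b′ then suc (length σ) else length σ)
                                                            (sym τ≡τ′) ⟩
      (if b′ then suc (length τ) else length τ)     ∎)

  restrict : List (Subset (3 + n)) → List (Subset (2 + n))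
  restrict σ = filter (λ T → (inside ∷ T) ∈? σ ⊎-dec (outside ∷ T) ∈? σ) (vertices (3 + n))

  raised-members : List (Subset (3 + n)) → List (Subset (2 + n))
  raised-members σ = filter (λ S → (inside ∷ S) ∈? σ) (allSubsets (2 + n))

  -- The raised sets of a face form a chain, so one of least size lies below all of them.
  centre : List (Subset (3 + n)) → Subset (2 + n)
  centre σ = argmin ∣_∣ ⊤ (raised-members σ)

  hasNewVertex : List (Subset (3 + n)) → Bool
  hasNewVertex σ = does (newVertex (centre σ) ∈? σ)

  module Restriction {σ : List (Subset (3 + n))} (σ∈F : σ ∈ faces (4 + n)) where

    private
      vσ = centre σ
      bσ = hasNewVertex σ
      τσ = restrict σ

    raised-size : (inside ∷ S) ∈ σ → 1 ≤ ∣ S ∣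
    raised-size x∈σ = ℕ.≤-pred (proj₁ (Δ₁.face-vertex σ∈F x∈σ))

    raised-nonempty : (inside ∷ S) ∈ σ → Nonempty S
    raised-nonempty {S} x∈σ = 1≤∣p∣⇒Nonempty S (raised-size x∈σ)

    ∈-raised-members : (inside ∷ S) ∈ σ → S ∈ raised-members σ
    ∈-raised-members {S} = ∈-filter⁺ (λ S → (inside ∷ S) ∈? σ) (∈-allSubsets S)

    centre-⊤-or-raised : vσ ≡ ⊤ ⊎ (inside ∷ vσ) ∈ σ
    centre-⊤-or-raised with argmin-sel ∣_∣ ⊤ (raised-members σ)
    ... | inj₁ v≡⊤ = inj₁ v≡⊤
    ... | inj₂ v∈ = inj₂ (proj₂ (∈-filter⁻ (λ S → (inside ∷ S) ∈? σ) {xs = allSubsets (2 + n)} v∈))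

    centre-≤-raised : (inside ∷ S) ∈ σ → ∣ vσ ∣ ≤ ∣ S ∣
    centre-≤-raised x∈σ = All.lookup (f[argmin]≤f[xs] ⊤ (raised-members σ)) (∈-raised-members x∈σ)

    centre-⊆-raised : (inside ∷ S) ∈ σ → vσ ⊆ S
    centre-⊆-raised {S} x∈σ with centre-⊤-or-raised
    ... | inj₁ vσ≡⊤ = subst (_⊆ S) (trans (p⊆q∧∣q∣≤∣p∣⇒p≡q ⊆⊤ ∣⊤∣≤∣S∣) (sym vσ≡⊤)) ⊆-refl
      where ∣⊤∣≤∣S∣ = subst (_≤ ∣ S ∣) (cong ∣_∣ vσ≡⊤) (centre-≤-raised x∈σ)
    ... | inj₂ vσ∈σ with inside-inside-compatible⁻ (Δ₁.face-pairwise σ∈F vσ∈σ x∈σ)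
    ...   | inj₁ vσ⊆S = vσ⊆S
    ...   | inj₂ S⊆vσ = subst (_⊆ S) (p⊆q∧∣q∣≤∣p∣⇒p≡q S⊆vσ (centre-≤-raised x∈σ)) ⊆-refl

    raised-vertex : (inside ∷ S) ∈ σ → 2 ≤ ∣ S ∣ → IsVertex (3 + n) S
    raised-vertex x∈σ 2≤∣S∣ = 2≤∣S∣ , ℕ.≤-pred (proj₂ (Δ₁.face-vertex σ∈F x∈σ))

    kept-vertex : (outside ∷ S) ∈ σ → S ≢ ⊤ → IsVertex (3 + n) S
    kept-vertex x∈σ S≢⊤ = let 2≤∣S∣ , ∣S∣≤2+n = Δ₁.face-vertex σ∈F x∈σ in
      2≤∣S∣ , ℕ.≤-pred (ℕ.≤∧≢⇒< ∣S∣≤2+n (S≢⊤ ∘ ∣p∣≡n⇒p≡⊤))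

    centre-size : 1 ≤ ∣ vσ ∣
    centre-size with centre-⊤-or-raised
    ... | inj₁ vσ≡⊤ = subst (1 ≤_) (sym (trans (cong ∣_∣ vσ≡⊤) ∣⊤∣≡2+n)) (s≤s z≤n)
    ... | inj₂ vσ∈σ = raised-size vσ∈σ

    kept-above-centre : (outside ∷ T) ∈ σ → vσ ⊆ T → T ≡ vσ
    kept-above-centre x∈σ vσ⊆T with centre-⊤-or-raised
    ... | inj₁ vσ≡⊤ = trans (⊆-antisym ⊆⊤ (subst (_⊆ _) vσ≡⊤ vσ⊆T)) (sym vσ≡⊤)
    ... | inj₂ vσ∈σ with inside-outside-compatible⁻ (Δ₁.face-pairwise σ∈F vσ∈σ x∈σ)
    ...   | inj₁ T⊆vσ = ⊆-antisym T⊆vσ vσ⊆T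
    ...   | inj₂ vσ∩T≡∅ = ⊥-elim (Nonempty-⊆⇒∩≢∅ (raised-nonempty vσ∈σ) ⊆-refl vσ⊆T vσ∩T≡∅)

    ∈-restrict⁺ : IsVertex (3 + n) T → (s ∷ T) ∈ σ → T ∈ τσ
    ∈-restrict⁺ {s = inside} T-vertex x∈σ = ∈-filter⁺ _ (Δ₀.∈-vertices⁺ T-vertex) (inj₁ x∈σ)
    ∈-restrict⁺ {s = outside} T-vertex x∈σ = ∈-filter⁺ _ (Δ₀.∈-vertices⁺ T-vertex) (inj₂ x∈σ)

    ∈-restrict⁻ : T ∈ τσ → IsVertex (3 + n) T × ∃[ s ] (s ∷ T) ∈ σ
    ∈-restrict⁻ T∈τσ with ∈-filter⁻ _ {xs = vertices (3 + n)} T∈τσ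
    ... | T∈V , inj₁ x∈σ = Δ₀.∈-vertices⁻ T∈V , inside , x∈σ
    ... | T∈V , inj₂ x∈σ = Δ₀.∈-vertices⁻ T∈V , outside , x∈σ

    restrict-face : τσ ∈ faces (3 + n)
    restrict-face = Δ₀.∈-faces⁺ (filter-⊆ _ (vertices (3 + n))) pairwise
      where
      pairwise : Pairwise τσ
      pairwise S∈τσ T∈τσ with ∈-restrict⁻ S∈τσ | ∈-restrict⁻ T∈τσ
      ... | _ , _ , x∈σ | _ , _ , y∈σ = compatible-tail (Δ₁.face-pairwise σ∈F x∈σ y∈σ)

    centre-valid : Centre τσ vσ bσ
    centre-valid with centre-⊤-or-raised
    ... | inj₁ vσ≡⊤ = subst (λ w → Centre τσ w bσ) (sym vσ≡⊤) whole
    ... | inj₂ vσ∈σ with ∣ vσ ∣ ≟ 1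
    ...   | no ∣vσ∣≢1 = member (∈-restrict⁺ (raised-vertex vσ∈σ 2≤∣vσ∣) vσ∈σ)
      where 2≤∣vσ∣ = ℕ.≤∧≢⇒< centre-size (∣vσ∣≢1 ∘ sym)
    ...   | yes ∣vσ∣≡1 with ∣p∣≡1⇒p≡⁅x⁆ vσ ∣vσ∣≡1
    ...     | i , vσ≡⁅i⁆ = subst₂ (Centre τσ) (sym vσ≡⁅i⁆) (sym bσ≡true) (point i)
      where
      bσ≡true : bσ ≡ true
      bσ≡true = dec-true (newVertex vσ ∈? σ) (subst (_∈ σ) (sym (newVertex-∣∣≡1 {vσ} ∣vσ∣≡1)) vσ∈σ)

    newVertex-∈-extension : x ∈ σ → x ≡ newVertex vσ → x ∈ extension τσ vσ bσ
    newVertex-∈-extension x∈σ refl =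
      subst (λ b → newVertex vσ ∈ extension τσ vσ b) (sym (dec-true (newVertex vσ ∈? σ) x∈σ)) (here refl)

    σ⊆extension : x ∈ σ → x ∈ extension τσ vσ bσ
    σ⊆extension {inside ∷ S} x∈σ with ∣ S ∣ ≟ 1
    ... | no ∣S∣≢1 = subst (_∈ extension τσ vσ bσ) (lift-⊆ {vσ} (centre-⊆-raised x∈σ))
      (lift-∈-extension bσ (∈-restrict⁺ (raised-vertex x∈σ 2≤∣S∣) x∈σ))
      where 2≤∣S∣ = ℕ.≤∧≢⇒< (raised-size x∈σ) (∣S∣≢1 ∘ sym)
    ... | yes ∣S∣≡1 = newVertex-∈-extension x∈σ
      (sym (trans (newVertex-∣∣≡1 {vσ} (trans (cong ∣_∣ vσ≡S) ∣S∣≡1)) (cong (inside ∷_) vσ≡S)))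
      where
      vσ≡S : vσ ≡ S
      vσ≡S = p⊆q∧∣q∣≤∣p∣⇒p≡q (centre-⊆-raised x∈σ) (subst (_≤ ∣ vσ ∣) (sym ∣S∣≡1) centre-size)
    σ⊆extension {outside ∷ S} x∈σ with vσ ⊆? S
    ... | yes vσ⊆S = newVertex-∈-extension x∈σ
      (sym (trans (newVertex-2≤∣∣ {vσ} (subst (λ w → 2 ≤ ∣ w ∣) S≡vσ (proj₁ (Δ₁.face-vertex σ∈F x∈σ))))
                  (cong (outside ∷_) (sym S≡vσ))))
      where S≡vσ = kept-above-centre x∈σ vσ⊆S
    ... | no vσ⊈S = subst (_∈ extension τσ vσ bσ) (lift-⊈ vσ⊈S)
      (lift-∈-extension bσ (∈-restrict⁺ (kept-vertex x∈σ S≢⊤) x∈σ))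
      where
      S≢⊤ : S ≢ ⊤
      S≢⊤ S≡⊤ = vσ⊈S (subst (vσ ⊆_) (sym S≡⊤) ⊆⊤)

    extension⊆σ : x ∈ extension τσ vσ bσ → x ∈ σ
    extension⊆σ x∈ with ∈-extension⁻ bσ x∈
    ... | inj₂ (bσ≡true , refl) = does-true (newVertex vσ ∈? σ) bσ≡true
    ... | inj₁ (T , T∈τσ , refl) with ∈-restrict⁻ T∈τσ
    ...   | T-vertex , inside , raised∈σ =
      lift-∈ (λ _ → raised∈σ) λ vσ⊈T → ⊥-elim (vσ⊈T (centre-⊆-raised raised∈σ))
    ...   | T-vertex , outside , kept∈σ = lift-∈ raised∈σ (λ _ → kept∈σ)
      where
      raised∈σ : vσ ⊆ T → (inside ∷ T) ∈ σ
      raised∈σ vσ⊆T with kept-above-centre kept∈σ vσ⊆T | centre-⊤-or-raised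
      ... | refl | inj₁ vσ≡⊤ = ⊥-elim (⊤-not-vertex (subst (IsVertex (3 + n)) vσ≡⊤ T-vertex))
      ... | refl | inj₂ vσ∈σ = vσ∈σ

    extend-restrict : extend τσ vσ bσ ≡ σ
    extend-restrict = ⊑-∼set⇒≡ Δ₁.Unique-vertices (filter-⊆ _ (vertices (4 + n))) (Δ₁.face-⊑ σ∈F)
      (mk⇔ (extension⊆σ ∘ Equivalence.to ext∼) (Equivalence.from ext∼ ∘ σ⊆extension))
      where ext∼ = extend∼extension restrict-face centre-valid

  Key : Set
  Key = List (Subset (2 + n)) × Subset (2 + n) × Bool

  Admissible : Key → Set
  Admissible (τ , v , b) = τ ∈ faces (3 + n) × Centre τ v b

  extendKey : Key → List (Subset (3 + n))
  extendKey (τ , v , b) = extend τ v b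

  keys : List (Subset (2 + n)) → List Key
  keys τ = map (λ v → τ , v , true) (centres τ true) ++ map (λ v → τ , v , false) (centres τ false)

  allKeys : List Key
  allKeys = concatMap keys (faces (3 + n))

  ∈-keys⁻ : ∀ {k} → k ∈ keys τ → proj₁ k ≡ τ × Centre τ (proj₁ (proj₂ k)) (proj₂ (proj₂ k))
  ∈-keys⁻ {τ} k∈ with ∈-++⁻ (map (λ v → τ , v , true) (centres τ true)) k∈
  ... | inj₁ k∈true with ∈-map⁻ _ k∈true
  ...   | v , v∈ , refl = refl , ∈-centres⁻ true v∈
  ∈-keys⁻ {τ} k∈ | inj₂ k∈false with ∈-map⁻ _ k∈false
  ...   | v , v∈ , refl = refl , ∈-centres⁻ false v∈

  ∈-allKeys⁻ : ∀ {k} → k ∈ allKeys → Admissible k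
  ∈-allKeys⁻ k∈ with find (∈-concatMap⁻ keys {xs = faces (3 + n)} k∈)
  ... | τ , τ∈F , k∈keys with ∈-keys⁻ k∈keys
  ...   | refl , c = τ∈F , c

  ∈-keys⁺ : Centre τ v b → (τ , v , b) ∈ keys τ
  ∈-keys⁺ {b = true} c = ∈-++⁺ˡ (∈-map⁺ _ (∈-centres⁺ c))
  ∈-keys⁺ {τ} {b = false} c = ∈-++⁺ʳ (map (λ v → τ , v , true) (centres τ true)) (∈-map⁺ _ (∈-centres⁺ c))

  ∈-allKeys⁺ : ∀ {k} → Admissible k → k ∈ allKeys
  ∈-allKeys⁺ (τ∈F , c) = ∈-concatMap⁺ keys (Any.map (λ { refl → ∈-keys⁺ c }) τ∈F)

  Unique-allKeys : Unique allKeys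
  Unique-allKeys = Unique.concat⁺
    (All.map⁺ (All.tabulate Unique-keys))
    (AllPairs.map⁺ (AllPairs.map keys-disjoint Δ₀.Unique-faces))
    where
    Unique-keys : τ ∈ faces (3 + n) → Unique (keys τ)
    Unique-keys {τ} τ∈F = Unique.++⁺
      (Unique.map⁺ (cong (proj₁ ∘ proj₂)) (Unique-centres τ∈F true))
      (Unique.map⁺ (cong (proj₁ ∘ proj₂)) (Unique-centres τ∈F false))
      bits-differ
      where
      bits-differ : ∀ {k} → ¬ (k ∈ map (λ v → τ , v , true) (centres τ true) ×
                               k ∈ map (λ v → τ , v , false) (centres τ false))
      bits-differ (k∈true , k∈false) with ∈-map⁻ _ k∈true | ∈-map⁻ _ k∈false
      ... | _ , _ , refl | _ , _ , ()
    keys-disjoint : τ ≢ τ′ → Disjoint (keys τ) (keys τ′)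
    keys-disjoint τ≢τ′ (k∈ , k∈′) = τ≢τ′ (trans (sym (proj₁ (∈-keys⁻ k∈))) (proj₁ (∈-keys⁻ k∈′)))

  faces↭extensions : faces (4 + n) ↭ map extendKey allKeys
  faces↭extensions = ∼bag⇒↭ (unique∧set⇒bag Δ₁.Unique-faces
    (Unique-map⁺-local extendKey-injective Unique-allKeys) (mk⇔ surjective image-face))
    where
    extendKey-injective : ∀ {k k′} → k ∈ allKeys → k′ ∈ allKeys → extendKey k ≡ extendKey k′ → k ≡ k′
    extendKey-injective k∈ k′∈ with ∈-allKeys⁻ k∈ | ∈-allKeys⁻ k′∈
    ... | τ∈F , c | τ′∈F , c′ = extend-injective τ∈F c τ′∈F c′
    surjective : ∀ {σ} → σ ∈ faces (4 + n) → σ ∈ map extendKey allKeys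
    surjective σ∈F = subst (_∈ map extendKey allKeys) extend-restrict
      (∈-map⁺ extendKey (∈-allKeys⁺ (restrict-face , centre-valid)))
      where open Restriction σ∈F
    image-face : ∀ {σ} → σ ∈ map extendKey allKeys → σ ∈ faces (4 + n)
    image-face σ∈ with ∈-map⁻ extendKey σ∈
    ... | k , k∈ , refl = let τ∈F , c = ∈-allKeys⁻ k∈ in extend-face τ∈F c

  extensionCount : ℕ → List (Subset (2 + n)) → ℕ
  extensionCount j τ = χ (suc (length τ) ≟ j) * (length τ + (3 + n)) + χ (length τ ≟ j) * suc (length τ)

  length-centres : ∀ τ → length (centres τ true) ≡ length τ + (3 + n)
  length-centres τ = begin
    suc (length (τ ++ points))                 ≡⟨ cong suc (List.length-++ τ) ⟩
    suc (length τ + length points)             ≡⟨ cong (λ l → suc (length τ + l))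
                                                       (List.length-map ⁅_⁆ (allFin (2 + n))) ⟩
    suc (length τ + length (allFin (2 + n)))   ≡⟨ cong (λ l → suc (length τ + l))
                                                       (List.length-tabulate id) ⟩
    suc (length τ + (2 + n))                   ≡⟨ sym (ℕ.+-suc (length τ) (2 + n)) ⟩
    length τ + (3 + n)                         ∎

  keys-count : ∀ j → τ ∈ faces (3 + n) → ∑[ k ∈ keys τ ] χ (length (extendKey k) ≟ j) ≡ extensionCount j τ
  keys-count {τ} j τ∈F = begin
    ∑[ k ∈ keys τ ] size k
      ≡⟨ ∑-++ (map (λ v → τ , v , true) (centres τ true)) _ size ⟩
    ∑[ k ∈ map (λ v → τ , v , true) (centres τ true) ] size k +
    ∑[ k ∈ map (λ v → τ , v , false) (centres τ false) ] size k
      ≡⟨ cong₂ _+_ (∑-map (λ v → τ , v , true) (centres τ true) size)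
                   (∑-map (λ v → τ , v , false) (centres τ false) size) ⟩
    ∑[ v ∈ centres τ true ] size (τ , v , true) + ∑[ v ∈ centres τ false ] size (τ , v , false)
      ≡⟨ cong₂ _+_ (∑-cong (centres τ true) (size-extend true))
                   (∑-cong (centres τ false) (size-extend false)) ⟩
    ∑[ v ∈ centres τ true ] χ (suc (length τ) ≟ j) + ∑[ v ∈ centres τ false ] χ (length τ ≟ j)
      ≡⟨ cong₂ _+_ (∑-const (centres τ true) (χ (suc (length τ) ≟ j)))
                   (∑-const (centres τ false) (χ (length τ ≟ j))) ⟩
    χ (suc (length τ) ≟ j) * length (centres τ true) + χ (length τ ≟ j) * suc (length τ)
      ≡⟨ cong (λ l → χ (suc (length τ) ≟ j) * l + χ (length τ ≟ j) * suc (length τ)) (length-centres τ) ⟩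
    extensionCount j τ ∎
    where
    size : Key → ℕ
    size k = χ (length (extendKey k) ≟ j)
    size-extend : ∀ b {v} → v ∈ centres τ b →
                  size (τ , v , b) ≡ χ ((if b then suc (length τ) else length τ) ≟ j)
    size-extend b {v} v∈ = cong (λ l → χ (l ≟ j))
      (trans (length-extend τ∈F (∈-centres⁻ b v∈)) (length-extension τ v b))

  F-step : ∀ j → F (4 + n) j ≡ ∑[ τ ∈ faces (3 + n) ] extensionCount j τ
  F-step j = begin
    F (4 + n) j
      ≡⟨ ↭-length (filter-↭ (λ σ → length σ ≟ j) faces↭extensions) ⟩
    length (filter (λ σ → length σ ≟ j) (map extendKey allKeys))
      ≡⟨ length-filter≡∑χ (λ σ → length σ ≟ j) (map extendKey allKeys) ⟩
    ∑[ σ ∈ map extendKey allKeys ] χ (length σ ≟ j)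
      ≡⟨ ∑-map extendKey allKeys (λ σ → χ (length σ ≟ j)) ⟩
    ∑[ k ∈ allKeys ] χ (length (extendKey k) ≟ j)
      ≡⟨ ∑-concatMap keys (faces (3 + n)) (λ k → χ (length (extendKey k) ≟ j)) ⟩
    ∑[ τ ∈ faces (3 + n) ] ∑[ k ∈ keys τ ] χ (length (extendKey k) ≟ j)
      ≡⟨ ∑-cong (faces (3 + n)) (keys-count j) ⟩
    ∑[ τ ∈ faces (3 + n) ] extensionCount j τ ∎

  F-zero-step : F (4 + n) 0 ≡ F (3 + n) 0
  F-zero-step = begin
    F (4 + n) 0
      ≡⟨ F-step 0 ⟩
    ∑[ τ ∈ faces (3 + n) ] (χ (length τ ≟ 0) * suc (length τ))
      ≡⟨ ∑-cong (faces (3 + n)) (λ {τ} _ → trans (χ-*-cong (length τ ≟ 0) (cong suc)) (ℕ.*-identityʳ _)) ⟩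
    ∑[ τ ∈ faces (3 + n) ] χ (length τ ≟ 0)
      ≡⟨ sym (F≡∑χ (3 + n) 0) ⟩
    F (3 + n) 0 ∎

  F-suc-step : ∀ j → F (4 + n) (suc j) ≡ (2 + j) * F (3 + n) (suc j) + (3 + n + j) * F (3 + n) j
  F-suc-step j = begin
    F (4 + n) (suc j)
      ≡⟨ F-step (suc j) ⟩
    ∑[ τ ∈ F₀ ] (χ (length τ ≟ j) * (length τ + (3 + n)) + χ (length τ ≟ suc j) * suc (length τ))
      ≡⟨ ∑-cong F₀ (λ {τ} _ → cong₂ _+_ (χ-*-cong (length τ ≟ j) (cong (_+ (3 + n))))
                                         (χ-*-cong (length τ ≟ suc j) (cong suc))) ⟩
    ∑[ τ ∈ F₀ ] (χ (length τ ≟ j) * (j + (3 + n)) + χ (length τ ≟ suc j) * (2 + j))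
      ≡⟨ ∑-+ F₀ _ _ ⟩
    ∑[ τ ∈ F₀ ] (χ (length τ ≟ j) * (j + (3 + n))) + ∑[ τ ∈ F₀ ] (χ (length τ ≟ suc j) * (2 + j))
      ≡⟨ cong₂ _+_ (∑-*ʳ (j + (3 + n)) F₀ _) (∑-*ʳ (2 + j) F₀ _) ⟩
    ∑[ τ ∈ F₀ ] χ (length τ ≟ j) * (j + (3 + n)) + ∑[ τ ∈ F₀ ] χ (length τ ≟ suc j) * (2 + j)
      ≡⟨ cong₂ (λ a b → a * (j + (3 + n)) + b * (2 + j))
               (sym (F≡∑χ (3 + n) j)) (sym (F≡∑χ (3 + n) (suc j))) ⟩
    F (3 + n) j * (j + (3 + n)) + F (3 + n) (suc j) * (2 + j)
      ≡⟨ solve 4 (λ j c a b → a :* (j :+ c) :+ b :* (con 2 :+ j) := (con 2 :+ j) :* b :+ (c :+ j) :* a)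
               refl j (3 + n) (F (3 + n) j) (F (3 + n) (suc j)) ⟩
    (2 + j) * F (3 + n) (suc j) + (3 + n + j) * F (3 + n) j ∎
    where
    open ℕ-Solver.+-*-Solver
    F₀ = faces (3 + n)

open import Data.Integer using (_+_; _*_; _-_)
open ListSum ℤ.+-*-commutativeSemiring

absorption : ∀ n k → suc k ℕ.* (suc n C suc k) ≡ suc n ℕ.* (n C k)
absorption zero zero = refl
absorption zero (suc k) = ℕ.*-zeroʳ (2 ℕ.+ k)
absorption (suc n) zero = trans (ℕ.+-identityʳ _) (trans (nC1≡n (2 ℕ.+ n)) (sym (ℕ.*-identityʳ (2 ℕ.+ n))))
absorption (suc n) (suc k) = begin
  (2 ℕ.+ k) ℕ.* ((2 ℕ.+ n) C (2 ℕ.+ k))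
    ≡⟨ cong ((2 ℕ.+ k) ℕ.*_) (sym (nCk+nC[k+1]≡[n+1]C[k+1] (suc n) (suc k))) ⟩
  (2 ℕ.+ k) ℕ.* (suc n C suc k ℕ.+ suc n C (2 ℕ.+ k))
    ≡⟨ solve 3 (λ k a b → (con 2 :+ k) :* (a :+ b) := a :+ (con 1 :+ k) :* a :+ (con 2 :+ k) :* b)
             refl k (suc n C suc k) (suc n C (2 ℕ.+ k)) ⟩
  suc n C suc k ℕ.+ suc k ℕ.* (suc n C suc k) ℕ.+ (2 ℕ.+ k) ℕ.* (suc n C (2 ℕ.+ k))
    ≡⟨ cong₂ (λ a b → suc n C suc k ℕ.+ a ℕ.+ b) (absorption n k) (absorption n (suc k)) ⟩
  suc n C suc k ℕ.+ suc n ℕ.* (n C k) ℕ.+ suc n ℕ.* (n C suc k)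
    ≡⟨ solve 4 (λ n c a b → c :+ (con 1 :+ n) :* a :+ (con 1 :+ n) :* b := c :+ (con 1 :+ n) :* (a :+ b))
             refl n (suc n C suc k) (n C k) (n C suc k) ⟩
  suc n C suc k ℕ.+ suc n ℕ.* (n C k ℕ.+ n C suc k)
    ≡⟨ cong (λ c → suc n C suc k ℕ.+ suc n ℕ.* c) (nCk+nC[k+1]≡[n+1]C[k+1] n k) ⟩
  suc n C suc k ℕ.+ suc n ℕ.* (suc n C suc k)
    ≡⟨⟩
  (2 ℕ.+ n) ℕ.* (suc n C suc k) ∎
  where open ℕ-Solver.+-*-Solver

absorption-+ : ∀ β ε → suc β ℕ.* ((β ℕ.+ ε) C suc β) ≡ ε ℕ.* ((β ℕ.+ ε) C β)
absorption-+ β ε = ℕ.+-cancelˡ-≡ (suc β ℕ.* X) _ _ (begin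
  suc β ℕ.* X ℕ.+ suc β ℕ.* Y   ≡⟨ sym (ℕ.*-distribˡ-+ (suc β) X Y) ⟩
  suc β ℕ.* (X ℕ.+ Y)           ≡⟨ cong (suc β ℕ.*_) (nCk+nC[k+1]≡[n+1]C[k+1] (β ℕ.+ ε) β) ⟩
  suc β ℕ.* (suc (β ℕ.+ ε) C suc β) ≡⟨ absorption (β ℕ.+ ε) β ⟩
  (suc β ℕ.+ ε) ℕ.* X           ≡⟨ ℕ.*-distribʳ-+ X (suc β) ε ⟩
  suc β ℕ.* X ℕ.+ ε ℕ.* X       ∎)
  where
  X = (β ℕ.+ ε) C β
  Y = (β ℕ.+ ε) C suc β

binomial-identity : ∀ β ε p q r t → q ℕ.+ ε ≡ p ℕ.+ t → r ≡ p ℕ.+ suc β →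
  let X = (β ℕ.+ ε) C β; Y = (β ℕ.+ ε) C suc β; Z = suc (β ℕ.+ ε) C suc β in
  X ℕ.* q ℕ.+ r ℕ.* Y ≡ Z ℕ.* p ℕ.+ t ℕ.* X
binomial-identity β ε p q r t q+ε≡p+t refl = begin
  X ℕ.* q ℕ.+ (p ℕ.+ suc β) ℕ.* Y
    ≡⟨ solve 5 (λ X Y p q b → X :* q :+ (p :+ b) :* Y := X :* q :+ p :* Y :+ b :* Y) refl X Y p q (suc β) ⟩
  X ℕ.* q ℕ.+ p ℕ.* Y ℕ.+ suc β ℕ.* Y
    ≡⟨ cong (X ℕ.* q ℕ.+ p ℕ.* Y ℕ.+_) (absorption-+ β ε) ⟩
  X ℕ.* q ℕ.+ p ℕ.* Y ℕ.+ ε ℕ.* X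
    ≡⟨ solve 5 (λ X Y p q e → X :* q :+ p :* Y :+ e :* X := X :* (q :+ e) :+ p :* Y) refl X Y p q ε ⟩
  X ℕ.* (q ℕ.+ ε) ℕ.+ p ℕ.* Y
    ≡⟨ cong (λ a → X ℕ.* a ℕ.+ p ℕ.* Y) q+ε≡p+t ⟩
  X ℕ.* (p ℕ.+ t) ℕ.+ p ℕ.* Y
    ≡⟨ solve 4 (λ X Y p t → X :* (p :+ t) :+ p :* Y := (X :+ Y) :* p :+ t :* X) refl X Y p t ⟩
  (X ℕ.+ Y) ℕ.* p ℕ.+ t ℕ.* X
    ≡⟨ cong (λ Z → Z ℕ.* p ℕ.+ t ℕ.* X) (nCk+nC[k+1]≡[n+1]C[k+1] (β ℕ.+ ε) β) ⟩
  Z ℕ.* p ℕ.+ t ℕ.* X ∎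
  where
  open ℕ-Solver.+-*-Solver
  X = (β ℕ.+ ε) C β
  Y = (β ℕ.+ ε) C suc β
  Z = suc (β ℕ.+ ε) C suc β

signed-identity : ∀ s x y z p q r t → x * q + r * y ≡ z * p + t * x →
                  (-1ℤ * s * z) * p + (s * x) * q ≡ r * (-1ℤ * s * y) + t * (s * x)
signed-identity s x y z p q r t eq = begin
  (-1ℤ * s * z) * p + (s * x) * q
    ≡⟨ solve 8 (λ s x y z p q r t → (con -1ℤ :* s :* z) :* p :+ (s :* x) :* q
                  := r :* (con -1ℤ :* s :* y) :+ t :* (s :* x)
                     :+ s :* ((x :* q :+ r :* y) :- (z :* p :+ t :* x)))
             refl s x y z p q r t ⟩
  r * (-1ℤ * s * y) + t * (s * x) + s * ((x * q + r * y) - (z * p + t * x))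
    ≡⟨ cong (λ a → r * (-1ℤ * s * y) + t * (s * x) + s * (a - (z * p + t * x))) eq ⟩
  r * (-1ℤ * s * y) + t * (s * x) + s * ((z * p + t * x) - (z * p + t * x))
    ≡⟨ solve 6 (λ s y r a w x → r :* (con -1ℤ :* s :* y) :+ a :+ s :* (w :- w)
                                := r :* (con -1ℤ :* s :* y) :+ a)
             refl s y r (t * (s * x)) (z * p + t * x) x ⟩
  r * (-1ℤ * s * y) + t * (s * x) ∎
  where open ℤ-Solver.+-*-Solver

signedBinomial : ℕ → ℕ → ℤ
signedBinomial δ β = -1ℤ ℤ.^ β * + (δ C β)

pos-*+* : ∀ a b c d → + (a ℕ.* b ℕ.+ c ℕ.* d) ≡ + a * + b + + c * + d
pos-*+* a b c d = trans (ℤ.pos-+ (a ℕ.* b) (c ℕ.* d)) (cong₂ _+_ (ℤ.pos-* a b) (ℤ.pos-* c d))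

coefficient-identity : ∀ β ε p q r t → q ℕ.+ ε ≡ p ℕ.+ t → r ≡ p ℕ.+ suc β →
  signedBinomial (suc (β ℕ.+ ε)) (suc β) * + p + signedBinomial (β ℕ.+ ε) β * + q ≡
  + r * signedBinomial (β ℕ.+ ε) (suc β) + + t * signedBinomial (β ℕ.+ ε) β
coefficient-identity β ε p q r t q+ε≡p+t r≡p+1+β =
  signed-identity (-1ℤ ℤ.^ β) (+ X) (+ Y) (+ Z) (+ p) (+ q) (+ r) (+ t)
    (trans (sym (pos-*+* X q r Y))
      (trans (cong +_ (binomial-identity β ε p q r t q+ε≡p+t r≡p+1+β)) (pos-*+* Z p t X)))
  where
  X = (β ℕ.+ ε) C β
  Y = (β ℕ.+ ε) C suc β
  Z = suc (β ℕ.+ ε) C suc β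

coeff : ℕ → ℕ → ℕ → ℤ
coeff d k i = signedBinomial (d ∸ i) (k ∸ i)

coeff-diag : ∀ d k → coeff d k k ≡ 1ℤ
coeff-diag d k rewrite ℕ.n∸n≡0 k = refl

∸-split : ∀ {i k d} → i ≤ k → k ≤ d → d ∸ i ≡ (k ∸ i) ℕ.+ (d ∸ k)
∸-split {i} {k} {d} i≤k k≤d = begin
  d ∸ i                             ≡⟨ cong (_∸ i) (sym (trans (cong (ℕ._+ (d ∸ k)) (ℕ.m+[n∸m]≡n i≤k))
                                                               (ℕ.m+[n∸m]≡n k≤d))) ⟩
  i ℕ.+ (k ∸ i) ℕ.+ (d ∸ k) ∸ i     ≡⟨ cong (_∸ i) (ℕ.+-assoc i (k ∸ i) (d ∸ k)) ⟩
  i ℕ.+ ((k ∸ i) ℕ.+ (d ∸ k)) ∸ i   ≡⟨ ℕ.m+n∸m≡n i _ ⟩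
  (k ∸ i) ℕ.+ (d ∸ k)               ∎

coeff-step : ∀ {d k i} → i ≤ k → k ≤ d →
  coeff (suc d) (suc k) i * + suc i + coeff (suc d) (suc k) (suc i) * + (3 ℕ.+ d ℕ.+ i) ≡
  + (2 ℕ.+ k) * coeff d (suc k) i + + (2 ℕ.+ d ℕ.+ (d ∸ k)) * coeff d k i
coeff-step {d} {k} {i} i≤k k≤d
  rewrite ℕ.+-∸-assoc 1 (ℕ.≤-trans i≤k k≤d) | ℕ.+-∸-assoc 1 i≤k | ∸-split i≤k k≤d =
  coefficient-identity (k ∸ i) (d ∸ k) (suc i) (3 ℕ.+ d ℕ.+ i) (2 ℕ.+ k) (2 ℕ.+ d ℕ.+ (d ∸ k))
    (solve 3 (λ d i e → con 3 :+ d :+ i :+ e := con 1 :+ i :+ (con 2 :+ d :+ e)) refl d i (d ∸ k))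
    (sym (trans (cong suc (ℕ.+-suc i (k ∸ i))) (cong (2 ℕ.+_) (ℕ.m+[n∸m]≡n i≤k))))
  where open ℕ-Solver.+-*-Solver

-- hFrom (m ∸ 3) (F m) unfolds to hSum m.
hFrom : ℕ → (ℕ → ℕ) → ℕ → ℤ
hFrom d g k = ∑[ i ∈ upTo (suc k) ] (coeff d k i * + g i)


∑-recurrence : ∀ (c : ℕ → ℤ) (g g′ β : ℕ → ℕ) K → g 0 ≡ g′ 0 →
  (∀ j → g (suc j) ≡ (2 ℕ.+ j) ℕ.* g′ (suc j) ℕ.+ β j ℕ.* g′ j) →
  ∑[ i ∈ upTo (suc K) ] (c i * + g i) ≡
  ∑[ i ∈ upTo (suc K) ] (c i * + suc i * + g′ i) + ∑[ i ∈ upTo K ] (c (suc i) * + β i * + g′ i)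
∑-recurrence c g g′ β K g0≡g′0 g-suc = begin
  ∑[ i ∈ upTo (suc K) ] (c i * + g i)
    ≡⟨ ∑-upTo-first K (λ i → c i * + g i) ⟩
  c 0 * + g 0 + ∑[ i ∈ upTo K ] (c (suc i) * + g (suc i))
    ≡⟨ cong₂ _+_ first (trans (∑-cong (upTo K) (λ {i} _ → split i)) (∑-+ (upTo K) (u ∘ suc) w)) ⟩
  u 0 + (∑ (upTo K) (u ∘ suc) + ∑ (upTo K) w)
    ≡⟨ sym (ℤ.+-assoc (u 0) _ _) ⟩
  u 0 + ∑ (upTo K) (u ∘ suc) + ∑ (upTo K) w
    ≡⟨ cong (_+ ∑ (upTo K) w) (sym (∑-upTo-first K u)) ⟩
  ∑ (upTo (suc K)) u + ∑ (upTo K) w ∎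
  where
  open ℤ-Solver.+-*-Solver
  u w : ℕ → ℤ
  u i = c i * + suc i * + g′ i
  w i = c (suc i) * + β i * + g′ i
  first : c 0 * + g 0 ≡ u 0
  first rewrite g0≡g′0 = solve 2 (λ c g → c :* g := c :* con 1ℤ :* g) refl (c 0) (+ g′ 0)
  split : ∀ i → c (suc i) * + g (suc i) ≡ u (suc i) + w i
  split i = begin
    c (suc i) * + g (suc i)
      ≡⟨ cong (λ x → c (suc i) * + x) (g-suc i) ⟩
    c (suc i) * + ((2 ℕ.+ i) ℕ.* g′ (suc i) ℕ.+ β i ℕ.* g′ i)
      ≡⟨ cong (c (suc i) *_) (pos-*+* (2 ℕ.+ i) (g′ (suc i)) (β i) (g′ i)) ⟩
    c (suc i) * (+ (2 ℕ.+ i) * + g′ (suc i) + + β i * + g′ i)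
      ≡⟨ solve 5 (λ c a x b y → c :* (a :* x :+ b :* y) := c :* a :* x :+ c :* b :* y)
               refl (c (suc i)) (+ (2 ℕ.+ i)) (+ g′ (suc i)) (+ β i) (+ g′ i) ⟩
    u (suc i) + w i ∎

coeff-step-scaled : ∀ {d k i} (g′ : ℕ → ℕ) → i ≤ k → k ≤ d →
  coeff (suc d) (suc k) i * + suc i * + g′ i + coeff (suc d) (suc k) (suc i) * + (3 ℕ.+ d ℕ.+ i) * + g′ i ≡
  + (2 ℕ.+ k) * (coeff d (suc k) i * + g′ i) + + (2 ℕ.+ d ℕ.+ (d ∸ k)) * (coeff d k i * + g′ i)
coeff-step-scaled {d} {k} {i} g′ i≤k k≤d = begin
  c₁ * + suc i * z + c₂ * + (3 ℕ.+ d ℕ.+ i) * z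
    ≡⟨ solve 5 (λ x p y q z → x :* p :* z :+ y :* q :* z := (x :* p :+ y :* q) :* z)
             refl c₁ (+ suc i) c₂ (+ (3 ℕ.+ d ℕ.+ i)) z ⟩
  (c₁ * + suc i + c₂ * + (3 ℕ.+ d ℕ.+ i)) * z
    ≡⟨ cong (_* z) (coeff-step i≤k k≤d) ⟩
  (r * coeff d (suc k) i + r′ * coeff d k i) * z
    ≡⟨ solve 5 (λ r x r′ y z → (r :* x :+ r′ :* y) :* z := r :* (x :* z) :+ r′ :* (y :* z))
             refl r (coeff d (suc k) i) r′ (coeff d k i) z ⟩
  r * (coeff d (suc k) i * z) + r′ * (coeff d k i * z) ∎
  where
  open ℤ-Solver.+-*-Solver
  c₁ = coeff (suc d) (suc k) i
  c₂ = coeff (suc d) (suc k) (suc i)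
  r = + (2 ℕ.+ k)
  r′ = + (2 ℕ.+ d ℕ.+ (d ∸ k))
  z = + g′ i

h-step : ∀ d (g g′ : ℕ → ℕ) → g 0 ≡ g′ 0 →
  (∀ j → g (suc j) ≡ (2 ℕ.+ j) ℕ.* g′ (suc j) ℕ.+ (3 ℕ.+ d ℕ.+ j) ℕ.* g′ j) →
  ∀ {k} → k ≤ d →
  hFrom (suc d) g (suc k) ≡ + (2 ℕ.+ k) * hFrom d g′ (suc k) + + (2 ℕ.+ d ℕ.+ (d ∸ k)) * hFrom d g′ k
h-step d g g′ g0≡g′0 g-suc {k} k≤d = begin
  hFrom (suc d) g K
    ≡⟨ ∑-recurrence (coeff (suc d) K) g g′ (λ j → 3 ℕ.+ d ℕ.+ j) K g0≡g′0 g-suc ⟩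
  ∑ (upTo (suc K)) u + ∑ (upTo K) w
    ≡⟨ cong (_+ ∑ (upTo K) w) (∑-upTo-last K u) ⟩
  ∑ (upTo K) u + u K + ∑ (upTo K) w
    ≡⟨ solve 3 (λ x y z → x :+ y :+ z := x :+ z :+ y) refl (∑ (upTo K) u) (u K) (∑ (upTo K) w) ⟩
  ∑ (upTo K) u + ∑ (upTo K) w + u K
    ≡⟨ cong₂ _+_ (trans (sym (∑-+ (upTo K) u w))
                        (∑-cong (upTo K) (λ i∈ → coeff-step-scaled g′ (ℕ.≤-pred (∈-upTo⁻ i∈)) k≤d)))
                 top ⟩
  ∑[ i ∈ upTo K ] (r * termₖ₊₁ i + r′ * termₖ i) + r * termₖ₊₁ K
    ≡⟨ cong (_+ r * termₖ₊₁ K) (trans (∑-+ (upTo K) (λ i → r * termₖ₊₁ i) (λ i → r′ * termₖ i))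
                                       (cong₂ _+_ (∑-*ˡ r (upTo K) termₖ₊₁) (∑-*ˡ r′ (upTo K) termₖ))) ⟩
  r * ∑ (upTo K) termₖ₊₁ + r′ * ∑ (upTo K) termₖ + r * termₖ₊₁ K
    ≡⟨ solve 5 (λ r A r′ B L → r :* A :+ r′ :* B :+ r :* L := r :* (A :+ L) :+ r′ :* B)
             refl r (∑ (upTo K) termₖ₊₁) r′ (∑ (upTo K) termₖ) (termₖ₊₁ K) ⟩
  r * (∑ (upTo K) termₖ₊₁ + termₖ₊₁ K) + r′ * ∑ (upTo K) termₖ
    ≡⟨ cong (λ x → r * x + r′ * ∑ (upTo K) termₖ) (sym (∑-upTo-last K termₖ₊₁)) ⟩
  r * hFrom d g′ K + r′ * hFrom d g′ k ∎
  where
  open ℤ-Solver.+-*-Solver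
  K = suc k
  r = + (2 ℕ.+ k)
  r′ = + (2 ℕ.+ d ℕ.+ (d ∸ k))
  u w termₖ₊₁ termₖ : ℕ → ℤ
  u i = coeff (suc d) K i * + suc i * + g′ i
  w i = coeff (suc d) K (suc i) * + (3 ℕ.+ d ℕ.+ i) * + g′ i
  termₖ₊₁ i = coeff d K i * + g′ i
  termₖ i = coeff d k i * + g′ i
  top : u K ≡ r * termₖ₊₁ K
  top rewrite coeff-diag (suc d) K | coeff-diag d K =
    solve 2 (λ r z → con 1ℤ :* r :* z := r :* (con 1ℤ :* z)) refl r (+ g′ K)

hFrom-zero : ∀ d g → hFrom d g 0 ≡ + g 0
hFrom-zero d g = trans (ℤ.+-identityʳ _) (ℤ.*-identityˡ (+ g 0))

hFrom-beyond : ∀ d g → g (suc d) ≡ 0 → hFrom d g (suc d) ≡ 0ℤ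
hFrom-beyond d g g-top = begin
  hFrom d g (suc d)
    ≡⟨ ∑-upTo-last (suc d) (λ i → coeff d (suc d) i * + g i) ⟩
  ∑[ i ∈ upTo (suc d) ] (coeff d (suc d) i * + g i) + coeff d (suc d) (suc d) * + g (suc d)
    ≡⟨ cong₂ _+_ (trans (∑-cong (upTo (suc d)) (λ i∈ → below-top (∈-upTo⁻ i∈))) (∑-zero (upTo (suc d))))
                 (trans (cong (λ x → coeff d (suc d) (suc d) * + x) g-top)
                        (ℤ.*-zeroʳ (coeff d (suc d) (suc d)))) ⟩
  0ℤ ∎
  where
  below-top : ∀ {i} → i < suc d → coeff d (suc d) i * + g i ≡ 0ℤ
  below-top {i} i<1+d rewrite ℕ.+-∸-assoc 1 (ℕ.≤-pred i<1+d) | k>n⇒nCk≡0 (ℕ.n<1+n (d ∸ i)) =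
    trans (cong (_* + g i) (ℤ.*-zeroʳ (-1ℤ ℤ.^ suc (d ∸ i)))) refl

F-vanishes : ∀ d j → d < j → F (3 ℕ.+ d) j ≡ 0
F-vanishes zero (suc j) _ = refl  -- Δ₃ has no vertices
F-vanishes (suc d) (suc j) (s≤s d<j) = begin
  F (4 ℕ.+ d) (suc j)
    ≡⟨ Step.F-suc-step d j ⟩
  (2 ℕ.+ j) ℕ.* F (3 ℕ.+ d) (suc j) ℕ.+ (3 ℕ.+ d ℕ.+ j) ℕ.* F (3 ℕ.+ d) j
    ≡⟨ cong₂ (λ a b → (2 ℕ.+ j) ℕ.* a ℕ.+ (3 ℕ.+ d ℕ.+ j) ℕ.* b)
             (F-vanishes d (suc j) (ℕ.m<n⇒m<1+n d<j)) (F-vanishes d j d<j) ⟩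
  (2 ℕ.+ j) ℕ.* 0 ℕ.+ (3 ℕ.+ d ℕ.+ j) ℕ.* 0
    ≡⟨ cong₂ ℕ._+_ (ℕ.*-zeroʳ (2 ℕ.+ j)) (ℕ.*-zeroʳ (3 ℕ.+ d ℕ.+ j)) ⟩
  0 ∎

h-in-range : ∀ m k → k ≤ m ∸ 3 → h m (+ k) ≡ hFrom (m ∸ 3) (F m) k
h-in-range m k k≤ = cong (λ b → if b then hSum m k else 0ℤ) (dec-true (k ℕ.≤? m ∸ 3) k≤)

h-out-of-range : ∀ m k → m ∸ 3 < k → h m (+ k) ≡ 0ℤ
h-out-of-range m k m∸3<k = cong (λ b → if b then hSum m k else 0ℤ) (dec-false (k ℕ.≤? m ∸ 3) (ℕ.<⇒≱ m∸3<k))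

h≡hFrom : ∀ d k → k ≤ suc d → h (3 ℕ.+ d) (+ k) ≡ hFrom d (F (3 ℕ.+ d)) k
h≡hFrom d k k≤1+d with ℕ.m≤n⇒m<n∨m≡n k≤1+d
... | inj₁ k<1+d = h-in-range (3 ℕ.+ d) k (ℕ.≤-pred k<1+d)
... | inj₂ refl = trans (h-out-of-range (3 ℕ.+ d) (suc d) ℕ.≤-refl)
                        (sym (hFrom-beyond d (F (3 ℕ.+ d)) (F-vanishes d (suc d) ℕ.≤-refl)))

h-zero-step : ∀ d → h (4 ℕ.+ d) (+ 0) ≡ h (3 ℕ.+ d) (+ 0)
h-zero-step d = begin
  h (4 ℕ.+ d) (+ 0)                 ≡⟨ h-in-range (4 ℕ.+ d) 0 z≤n ⟩
  hFrom (suc d) (F (4 ℕ.+ d)) 0     ≡⟨ hFrom-zero (suc d) (F (4 ℕ.+ d)) ⟩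
  + F (4 ℕ.+ d) 0                   ≡⟨ cong +_ (Step.F-zero-step d) ⟩
  + F (3 ℕ.+ d) 0                   ≡⟨ sym (hFrom-zero d (F (3 ℕ.+ d))) ⟩
  hFrom d (F (3 ℕ.+ d)) 0           ≡⟨ sym (h-in-range (3 ℕ.+ d) 0 z≤n) ⟩
  h (3 ℕ.+ d) (+ 0)                 ∎

h-suc-step : ∀ d k → k ≤ d →
  h (4 ℕ.+ d) (+ suc k) ≡ + (2 ℕ.+ k) * h (3 ℕ.+ d) (+ suc k) + + (2 ℕ.+ d ℕ.+ (d ∸ k)) * h (3 ℕ.+ d) (+ k)
h-suc-step d k k≤d = begin
  h (4 ℕ.+ d) (+ suc k)
    ≡⟨ h-in-range (4 ℕ.+ d) (suc k) (s≤s k≤d) ⟩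
  hFrom (suc d) (F (4 ℕ.+ d)) (suc k)
    ≡⟨ h-step d (F (4 ℕ.+ d)) (F (3 ℕ.+ d)) (Step.F-zero-step d) (Step.F-suc-step d) k≤d ⟩
  + (2 ℕ.+ k) * hFrom d (F (3 ℕ.+ d)) (suc k) + + (2 ℕ.+ d ℕ.+ (d ∸ k)) * hFrom d (F (3 ℕ.+ d)) k
    ≡⟨ cong₂ (λ a b → + (2 ℕ.+ k) * a + + (2 ℕ.+ d ℕ.+ (d ∸ k)) * b)
             (sym (h≡hFrom d (suc k) (s≤s k≤d))) (sym (h-in-range (3 ℕ.+ d) k k≤d)) ⟩
  + (2 ℕ.+ k) * h (3 ℕ.+ d) (+ suc k) + + (2 ℕ.+ d ℕ.+ (d ∸ k)) * h (3 ℕ.+ d) (+ k) ∎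

private
  twice-4+d : ∀ d k → k ≤ d → 2 ℕ.* (4 ℕ.+ d) ≡ 2 ℕ.+ d ℕ.+ (d ∸ k) ℕ.+ suc k ℕ.+ 5
  twice-4+d d k k≤d = begin
    2 ℕ.* (4 ℕ.+ d)                       ≡⟨ solve 1 (λ d → con 2 :* (con 4 :+ d) := con 8 :+ d :+ d) refl d ⟩
    8 ℕ.+ d ℕ.+ d                         ≡⟨ cong (8 ℕ.+ d ℕ.+_) (sym (ℕ.m∸n+n≡m k≤d)) ⟩
    8 ℕ.+ d ℕ.+ ((d ∸ k) ℕ.+ k)           ≡⟨ solve 3 (λ d e k → con 8 :+ d :+ (e :+ k)
                                                          := con 2 :+ d :+ e :+ (con 1 :+ k) :+ con 5)
                                                  refl d (d ∸ k) k ⟩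
    2 ℕ.+ d ℕ.+ (d ∸ k) ℕ.+ suc k ℕ.+ 5   ∎
    where open ℕ-Solver.+-*-Solver

coefficient-2n-k-5 : ∀ d k → k ≤ d → + 2 * + (4 ℕ.+ d) - + suc k - + 5 ≡ + (2 ℕ.+ d ℕ.+ (d ∸ k))
coefficient-2n-k-5 d k k≤d = begin
  + 2 * + (4 ℕ.+ d) - + suc k - + 5
    ≡⟨ cong (λ x → x - + suc k - + 5) (sym (ℤ.pos-* 2 (4 ℕ.+ d))) ⟩
  + (2 ℕ.* (4 ℕ.+ d)) - + suc k - + 5
    ≡⟨ cong (λ x → + x - + suc k - + 5) (twice-4+d d k k≤d) ⟩
  + (W ℕ.+ suc k ℕ.+ 5) - + suc k - + 5
    ≡⟨ cong (λ x → x - + suc k - + 5)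
            (trans (ℤ.pos-+ (W ℕ.+ suc k) 5) (cong (_+ + 5) (ℤ.pos-+ W (suc k)))) ⟩
  + W + + suc k + + 5 - + suc k - + 5
    ≡⟨ solve 3 (λ w x y → w :+ x :+ y :- x :- y := w) refl (+ W) (+ suc k) (+ 5) ⟩
  + W ∎
  where
  open ℤ-Solver.+-*-Solver
  W = 2 ℕ.+ d ℕ.+ (d ∸ k)

corollary3p5 : (n : ℕ) → 4 ≤ n → (k : ℕ) → k ≤ n ∸ 3 →
    h n (+ k) ≡ (+ k + + 1) * h (n ∸ 1) (+ k) + (+ 2 * + n - + k - + 5) * h (n ∸ 1) (+ k - + 1)
corollary3p5 (suc (suc (suc (suc d)))) (s≤s (s≤s (s≤s (s≤s _)))) zero _ = begin
  h (4 ℕ.+ d) (+ 0)                                              ≡⟨ h-zero-step d ⟩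
  h (3 ℕ.+ d) (+ 0)                                              ≡⟨ sym (ℤ.*-identityˡ _) ⟩
  1ℤ * h (3 ℕ.+ d) (+ 0)                                         ≡⟨ sym (ℤ.+-identityʳ _) ⟩
  1ℤ * h (3 ℕ.+ d) (+ 0) + 0ℤ                                    ≡⟨ cong (λ x → 1ℤ * h (3 ℕ.+ d) (+ 0) + x)
                                                                          (sym (ℤ.*-zeroʳ c)) ⟩
  1ℤ * h (3 ℕ.+ d) (+ 0) + c * 0ℤ                                ∎
  where c = + 2 * + (4 ℕ.+ d) - + 0 - + 5
corollary3p5 (suc (suc (suc (suc d)))) (s≤s (s≤s (s≤s (s≤s _)))) (suc k) (s≤s k≤d) = begin
  h (4 ℕ.+ d) (+ suc k)
    ≡⟨ h-suc-step d k k≤d ⟩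
  + (2 ℕ.+ k) * h (3 ℕ.+ d) (+ suc k) + + (2 ℕ.+ d ℕ.+ (d ∸ k)) * h (3 ℕ.+ d) (+ k)
    ≡⟨ cong₂ (λ a b → a * h (3 ℕ.+ d) (+ suc k) + b * h (3 ℕ.+ d) (+ k))
             (cong +_ (ℕ.+-comm 1 (suc k))) (sym (coefficient-2n-k-5 d k k≤d)) ⟩
  (+ suc k + + 1) * h (3 ℕ.+ d) (+ suc k) +
  (+ 2 * + (4 ℕ.+ d) - + suc k - + 5) * h (3 ℕ.+ d) (+ suc k - + 1) ∎
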